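{- Let $m,n,s,k,c$ be positive integers such that $2\leq s\leq n$, $2\leq k\leq m$ and $ms=nk$. Suppose that $s$ and $k$ are both even and $(s,k)\neq(2,2)$. Then there exists a $\mathrm{M}^0\mathrm{S}_{\mathbb{Z}_{nkc+1}^*}(m,n;s,k;c)$.
   Context: A partially filled array of size $m\times n$ is an $m\times n$ array in which some cells may be empty. Given a subset $\Omega$ of an abelian group $(\Gamma,+)$, a $\mathrm{M}^0\mathrm{S}_\Omega(m,n;s,k;c)$ is a set of $c$ partially filled $m\times n$ arrays with entries in $\Omega$ such that every element of $\Omega$ appears exactly once, in exactly one of the arrays; in every array each row has exactly $s$ filled cells and each column has exactly $k$ filled cells; and in every array the entries of each row and of each column sum to $0\in\Gamma$. $\mathbb{Z}_N^*$ denotes the set of nonzero elements of the cyclic group $\mathbb{Z}_N$. -}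

module Defs where

open import Data.Nat using (ℕ; zero; suc; _+_; _*_; _%_)
open import Data.Fin using (Fin; toℕ)
open import Data.Maybe using (Maybe; just; nothing)
open import Data.List using (List; map; allFin)
open import Data.Nat.ListAction using (sum)
open import Data.Product using (Σ; _×_; _,_)
open import Relation.Binary.PropositionalEquality using (_≡_; _≢_)

-- Elements of the cyclic group ℤ_N are represented as Fin N (residues 0..N-1);
-- addition is addition of representatives taken mod N.

PArray : ℕ → ℕ → ℕ → Set
PArray N m n = Fin m → Fin n → Maybe (Fin N)

filled : ∀ {N} → Maybe (Fin N) → ℕ
filled (just _) = 1
filled nothing  = 0

val : ∀ {N} → Maybe (Fin N) → ℕ
val (just x) = toℕ x
val nothing  = 0

Σ< : (n : ℕ) → (Fin n → ℕ) → ℕ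
Σ< n f = sum (map f (allFin n))

rowCount : ∀ {N m n} → PArray N m n → Fin m → ℕ
rowCount {n = n} A i = Σ< n (λ j → filled (A i j))

colCount : ∀ {N m n} → PArray N m n → Fin n → ℕ
colCount {m = m} A j = Σ< m (λ i → filled (A i j))

rowSum : ∀ {m n} (N : ℕ) → PArray (suc N) m n → Fin m → ℕ
rowSum {n = n} N A i = Σ< n (λ j → val (A i j)) % suc N

colSum : ∀ {m n} (N : ℕ) → PArray (suc N) m n → Fin n → ℕ
colSum {m = m} N A j = Σ< m (λ i → val (A i j)) % suc N

IsM0S : (N m n s k c : ℕ) → (Fin c → PArray (suc N) m n) → Set
IsM0S N m n s k c A =
  (∀ a i j (x : Fin (suc N)) → A a i j ≡ just x → toℕ x ≢ 0)
  × (∀ (x : Fin (suc N)) → toℕ x ≢ 0 →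
       Σ (Fin c) λ a → Σ (Fin m) λ i → Σ (Fin n) λ j → A a i j ≡ just x)
  × (∀ a i j a' i' j' (x : Fin (suc N)) → A a i j ≡ just x → A a' i' j' ≡ just x →
       (a ≡ a') × (i ≡ i') × (j ≡ j'))
  × (∀ a i → rowCount (A a) i ≡ s)
  × (∀ a j → colCount (A a) j ≡ k)
  × (∀ a i → rowSum N (A a) i ≡ 0)
  × (∀ a j → colSum N (A a) j ≡ 0)

M0S-exists : (m n s k c : ℕ) → Set
M0S-exists m n s k c =
  Σ (Fin c → PArray (suc (n * k * c)) m n) (IsM0S (n * k * c) m n s k c)

{-# OPTIONS --safe #-}
-- Fill every array along cyclic diagonals: row i occupies the s columns i s, …, i s + s − 1 modulo n.
-- Read row by row, the n k filled cells of an array then form a segment of one long sequence in which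
-- each row is a block of s consecutive terms and each column a residue class of positions modulo n, so
-- it suffices to order the residues ±1, …, ±nkc/2 modulo nkc + 1 suitably. Terms 2x and 2x + 1 are ±μ x
-- with opposite signs, so every row (s even, blocks aligned) sums to zero, and the magnitudes μ and their
-- signs are chosen so that every column does too. For n = 2q + 1, column 2r combines two columns of
-- magnitudes whose signed sums agree; when k/2 is odd, permutations α, β of [0, n) with α r + β r = q + r
-- make this true for the three leading rows. For n even, each column is a group of k magnitudes built
-- from quadruples x − (x + 1) − (x + 2) + (x + 3) and, when k/2 is odd, one block of six whose signed sum
-- is 0 or exactly nkc + 1. When k = 2 the hypothesis (s, k) ≠ (2, 2) forces s ≥ 4, and one transposes.

module Submission where

open import Defs
open import Data.Nat using (ℕ; zero; suc; _+_; _*_; _∸_; _≤_; _<_; z≤n; s≤s; _%_; _/_; NonZero; >-nonZero; _≟_; _<?_; _≤?_)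
open import Data.Nat.Properties
open import Data.Nat.DivMod
  using (%-distribˡ-+; m%n%n≡m%n; m%n<n; m%n≤n; m*n%n≡0; m*n/n≡m; m<n⇒m%n≡m; [m+kn]%n≡m%n; m≡m%n+[m/n]*n; m<n*o⇒m/o<n; m/n*n≤m)
open import Data.Nat.Divisibility using (_∣_; divides)
open import Data.Nat.ListAction using (sum)
open import Data.Nat.Tactic.RingSolver using (solve-∀)
open import Algebra.Properties.CommutativeSemigroup +-commutativeSemigroup using (interchange)
open import Data.Bool using (Bool; true; false; not; if_then_else_)
open import Data.Bool.Properties using (if-not; not-¬)
open import Data.Empty using (⊥; ⊥-elim)
open import Data.Fin as Fin using (Fin; toℕ; fromℕ<; punchOut)
open import Data.Fin.Properties using (toℕ-injective; toℕ-fromℕ<; toℕ<n; any?; pigeonhole; punchOut-injective) renaming (_≟_ to _≟ᶠ_)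
open import Data.List using (map; allFin; tabulate)
open import Data.List.Properties using (map-tabulate; map-cong)
open import Data.Maybe using (Maybe; just; nothing)
open import Data.Product as Product using (Σ; ∃; ∃₂; _×_; _,_; proj₁; proj₂)
open import Function using (_∘_; id)
open import Function.Bundles using (_⇔_; mk⇔)
open import Relation.Nullary using (Dec; does; ¬_; yes; no; contradiction)
open import Relation.Nullary.Decidable using (does-⇔)
open import Relation.Binary.PropositionalEquality


-- Finite sums

∑ : ℕ → (ℕ → ℕ) → ℕ
∑ zero    f = 0
∑ (suc n) f = f 0 + ∑ n (f ∘ suc)

syntax ∑ n (λ i → e) = ∑[ i < n ] e

∑-cong : ∀ n {f g : ℕ → ℕ} → (∀ i → i < n → f i ≡ g i) → ∑ n f ≡ ∑ n g
∑-cong zero    eq = refl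
∑-cong (suc n) eq = cong₂ _+_ (eq 0 (s≤s z≤n)) (∑-cong n (λ i i<n → eq (suc i) (s≤s i<n)))

∑-const : ∀ n x → ∑[ _ < n ] x ≡ n * x
∑-const zero    x = refl
∑-const (suc n) x = cong (x +_) (∑-const n x)

∑-distrib-+ : ∀ n (f g : ℕ → ℕ) → ∑[ i < n ] (f i + g i) ≡ ∑ n f + ∑ n g
∑-distrib-+ zero    f g = refl
∑-distrib-+ (suc n) f g = trans (cong (f 0 + g 0 +_) (∑-distrib-+ n (f ∘ suc) (g ∘ suc)))
                                (interchange (f 0) (g 0) _ _)

∑-zero : ∀ n → ∑[ _ < n ] 0 ≡ 0
∑-zero n = trans (∑-const n 0) (*-zeroʳ n)

∑-distribʳ-* : ∀ n (f : ℕ → ℕ) x → ∑[ i < n ] (f i * x) ≡ ∑ n f * x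
∑-distribʳ-* zero    f x = refl
∑-distribʳ-* (suc n) f x =
  trans (cong (f 0 * x +_) (∑-distribʳ-* n (f ∘ suc) x)) (sym (*-distribʳ-+ x (f 0) _))

∑-+ : ∀ a b (f : ℕ → ℕ) → ∑ (a + b) f ≡ ∑ a f + ∑[ i < b ] f (a + i)
∑-+ zero    b f = refl
∑-+ (suc a) b f = trans (cong (f 0 +_) (∑-+ a b (f ∘ suc))) (sym (+-assoc (f 0) _ _))

∑-* : ∀ m s (f : ℕ → ℕ) → ∑ (m * s) f ≡ ∑[ i < m ] ∑[ u < s ] f (i * s + u)
∑-* zero    s f = refl
∑-* (suc m) s f = begin
  ∑ (s + m * s) f                                         ≡⟨ ∑-+ s (m * s) f ⟩
  ∑ s f + ∑[ t < m * s ] f (s + t)                        ≡⟨ cong (∑ s f +_) (∑-* m s (λ t → f (s + t))) ⟩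
  ∑ s f + ∑[ i < m ] ∑[ u < s ] f (s + (i * s + u))       ≡⟨ cong (∑ s f +_) (∑-cong m (λ i _ → ∑-cong s (λ u _ →
                                                               cong f (sym (+-assoc s (i * s) u))))) ⟩
  ∑ s f + ∑[ i < m ] ∑[ u < s ] f (suc i * s + u)         ∎
  where open ≡-Reasoning

∑-pairs : ∀ h (f : ℕ → ℕ) → ∑ (h * 2) f ≡ ∑[ p < h ] (f (p * 2) + f (suc (p * 2)))
∑-pairs h f = trans (∑-* h 2 f) (∑-cong h (λ p _ →
  cong₂ _+_ (cong f (+-identityʳ (p * 2))) (trans (+-identityʳ _) (cong f (+-comm (p * 2) 1)))))

∑-comm : ∀ a b (f : ℕ → ℕ → ℕ) → ∑[ i < a ] ∑[ j < b ] f i j ≡ ∑[ j < b ] ∑[ i < a ] f i j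
∑-comm zero    b f = sym (∑-zero b)
∑-comm (suc a) b f = begin
  ∑ b (f 0) + ∑[ i < a ] ∑[ j < b ] f (suc i) j ≡⟨ cong (∑ b (f 0) +_) (∑-comm a b (f ∘ suc)) ⟩
  ∑ b (f 0) + ∑[ j < b ] ∑[ i < a ] f (suc i) j ≡⟨ ∑-distrib-+ b (f 0) _ ⟨
  ∑[ j < b ] ∑[ i < suc a ] f i j               ∎
  where open ≡-Reasoning

when : ∀ {a} {A : Set a} → Dec A → ℕ → ℕ
when a? x = if does a? then x else 0

when-cong : ∀ {a b} {A : Set a} {B : Set b} → A ⇔ B → (a? : Dec A) (b? : Dec B) → ∀ x → when a? x ≡ when b? x
when-cong A⇔B a? b? x = cong (λ t → if t then x else 0) (does-⇔ A⇔B a? b?)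

∑-when-≡ : ∀ n c (f : ℕ → ℕ) → c < n → ∑[ j < n ] when (j ≟ c) (f j) ≡ f c
∑-when-≡ (suc n) zero    f _         = trans (cong (f 0 +_) (∑-zero n)) (+-identityʳ (f 0))
∑-when-≡ (suc n) (suc c) f (s≤s c<n) = ∑-when-≡ n c (f ∘ suc) c<n

∑-when-≡-out : ∀ n c (f : ℕ → ℕ) → n ≤ c → ∑[ j < n ] when (j ≟ c) (f j) ≡ 0
∑-when-≡-out zero    c       f _         = refl
∑-when-≡-out (suc n) (suc c) f (s≤s n≤c) = ∑-when-≡-out n c (f ∘ suc) n≤c

Σ<≡∑ : ∀ n (g : Fin n → ℕ) (f : ℕ → ℕ) → (∀ j → g j ≡ f (toℕ j)) → sum (map g (allFin n)) ≡ ∑ n f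
Σ<≡∑ n g f eq = begin
  sum (map g (allFin n))                   ≡⟨ cong sum (map-cong eq (allFin n)) ⟩
  sum (map (f ∘ toℕ) (tabulate {n = n} id)) ≡⟨ cong sum (map-tabulate {n = n} id (f ∘ toℕ)) ⟩
  sum (tabulate {n = n} (f ∘ toℕ))          ≡⟨ sum-tabulate n f ⟩
  ∑ n f                                    ∎
  where
  open ≡-Reasoning
  sum-tabulate : ∀ n (f : ℕ → ℕ) → sum (tabulate {n = n} (f ∘ toℕ)) ≡ ∑ n f
  sum-tabulate zero    f = refl
  sum-tabulate (suc n) f = cong (f 0 +_) (sum-tabulate n (f ∘ suc))

∑-% : ∀ n (f : ℕ → ℕ) d .{{_ : NonZero d}} → (∑[ i < n ] (f i % d)) % d ≡ ∑ n f % d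
∑-% zero    f d = refl
∑-% (suc n) f d = begin
  (f 0 % d + ∑[ i < n ] (f (suc i) % d)) % d          ≡⟨ %-distribˡ-+ (f 0 % d) _ d ⟩
  (f 0 % d % d + ∑[ i < n ] (f (suc i) % d) % d) % d  ≡⟨ cong₂ (λ u v → (u + v) % d) (m%n%n≡m%n (f 0) d) (∑-% n (f ∘ suc) d) ⟩
  (f 0 % d + ∑ n (f ∘ suc) % d) % d                  ≡⟨ %-distribˡ-+ (f 0) _ d ⟨
  (f 0 + ∑ n (f ∘ suc)) % d                          ∎
  where open ≡-Reasoning

-- Digits and residues

digit-bound : ∀ {q r c d} → q < c → r < d → q * d + r < c * d
digit-bound {q} {r} {c} {d} q<c r<d = begin-strict
  q * d + r <⟨ +-monoʳ-< (q * d) r<d ⟩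
  q * d + d ≡⟨ +-comm (q * d) d ⟩
  suc q * d ≤⟨ *-monoˡ-≤ d q<c ⟩
  c * d     ∎
  where open ≤-Reasoning

digits-injective : ∀ {q r q′ r′} d .{{_ : NonZero d}} → r < d → r′ < d →
                   q * d + r ≡ q′ * d + r′ → q ≡ q′ × r ≡ r′
digits-injective {q} {r} {q′} {r′} d r<d r′<d eq = *-cancelʳ-≡ q q′ d (+-cancelʳ-≡ r _ _ q*d+r≡q′*d+r) , r≡r′
  where
  open ≡-Reasoning
  r≡r′ : r ≡ r′
  r≡r′ = begin
    r                ≡⟨ m<n⇒m%n≡m r<d ⟨
    r % d            ≡⟨ [m+kn]%n≡m%n r q d ⟨
    (r + q * d) % d  ≡⟨ cong (_% d) (trans (+-comm r (q * d)) (trans eq (+-comm (q′ * d) r′))) ⟩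
    (r′ + q′ * d) % d ≡⟨ [m+kn]%n≡m%n r′ q′ d ⟩
    r′ % d           ≡⟨ m<n⇒m%n≡m r′<d ⟩
    r′               ∎
  q*d+r≡q′*d+r : q * d + r ≡ q′ * d + r
  q*d+r≡q′*d+r = trans eq (cong (q′ * d +_) (sym r≡r′))

digits-of : ∀ q r d .{{_ : NonZero d}} → r < d → (q * d + r) / d ≡ q × (q * d + r) % d ≡ r
digits-of q r d r<d = digits-injective d (m%n<n (q * d + r) d) r<d (sym (begin
  q * d + r                                       ≡⟨ +-comm (q * d) r ⟩
  r + q * d                                       ≡⟨ m≡m%n+[m/n]*n (r + q * d) d ⟩
  (r + q * d) % d + (r + q * d) / d * d           ≡⟨ +-comm ((r + q * d) % d) _ ⟩
  (r + q * d) / d * d + (r + q * d) % d           ≡⟨ cong (λ t → t / d * d + t % d) (+-comm r (q * d)) ⟩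
  (q * d + r) / d * d + (q * d + r) % d           ∎))
  where open ≡-Reasoning

-- The residue of j − x modulo n; adding n ∸ x % n instead of subtracting x avoids truncation.
subMod : (n j x : ℕ) .{{_ : NonZero n}} → ℕ
subMod n j x = (j + (n ∸ x % n)) % n

private
  x+[n∸x%n]≡[1+x/n]*n : ∀ x n .{{_ : NonZero n}} → x + (n ∸ x % n) ≡ suc (x / n) * n
  x+[n∸x%n]≡[1+x/n]*n x n = begin
    x + (n ∸ x % n)                    ≡⟨ cong (_+ (n ∸ x % n)) (m≡m%n+[m/n]*n x n) ⟩
    (x % n + x / n * n) + (n ∸ x % n)  ≡⟨ +-comm (x % n + x / n * n) _ ⟩
    (n ∸ x % n) + (x % n + x / n * n)  ≡⟨ +-assoc (n ∸ x % n) (x % n) _ ⟨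
    ((n ∸ x % n) + x % n) + x / n * n  ≡⟨ cong (_+ x / n * n) (m∸n+n≡m (m%n≤n x n)) ⟩
    n + x / n * n                      ∎
    where open ≡-Reasoning

  [a+b%n]%n≡[a+b]%n : ∀ a b n .{{_ : NonZero n}} → (a + b % n) % n ≡ (a + b) % n
  [a+b%n]%n≡[a+b]%n a b n = begin
    (a + b % n) % n           ≡⟨ %-distribˡ-+ a (b % n) n ⟩
    (a % n + b % n % n) % n   ≡⟨ cong (λ z → (a % n + z) % n) (m%n%n≡m%n b n) ⟩
    (a % n + b % n) % n       ≡⟨ %-distribˡ-+ a b n ⟨
    (a + b) % n               ∎
    where open ≡-Reasoning

  [a+[x+[n∸x%n]]]%n≡a%n : ∀ a x n .{{_ : NonZero n}} → (a + (x + (n ∸ x % n))) % n ≡ a % n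
  [a+[x+[n∸x%n]]]%n≡a%n a x n =
    trans (cong (λ z → (a + z) % n) (x+[n∸x%n]≡[1+x/n]*n x n)) ([m+kn]%n≡m%n a (suc (x / n)) n)

+-subMod : ∀ {j} x n .{{_ : NonZero n}} → j < n → (x + subMod n j x) % n ≡ j
+-subMod {j} x n j<n = begin
  (x + (j + (n ∸ x % n)) % n) % n ≡⟨ [a+b%n]%n≡[a+b]%n x _ n ⟩
  (x + (j + (n ∸ x % n))) % n     ≡⟨ cong (_% n) (x+[y+z]≡y+[x+z] x j _) ⟩
  (j + (x + (n ∸ x % n))) % n     ≡⟨ [a+[x+[n∸x%n]]]%n≡a%n j x n ⟩
  j % n                           ≡⟨ m<n⇒m%n≡m j<n ⟩
  j                               ∎
  where
  open ≡-Reasoning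
  x+[y+z]≡y+[x+z] : ∀ x y z → x + (y + z) ≡ y + (x + z)
  x+[y+z]≡y+[x+z] = solve-∀

subMod-unique : ∀ {u} x n .{{_ : NonZero n}} → u < n → subMod n ((x + u) % n) x ≡ u
subMod-unique {u} x n u<n = begin
  ((x + u) % n + (n ∸ x % n)) % n ≡⟨ cong (_% n) (+-comm ((x + u) % n) _) ⟩
  ((n ∸ x % n) + (x + u) % n) % n ≡⟨ [a+b%n]%n≡[a+b]%n (n ∸ x % n) (x + u) n ⟩
  ((n ∸ x % n) + (x + u)) % n     ≡⟨ cong (_% n) (y+[x+u]≡u+[x+y] (n ∸ x % n) x u) ⟩
  (u + (x + (n ∸ x % n))) % n     ≡⟨ [a+[x+[n∸x%n]]]%n≡a%n u x n ⟩
  u % n                           ≡⟨ m<n⇒m%n≡m u<n ⟩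
  u                               ∎
  where
  open ≡-Reasoning
  y+[x+u]≡u+[x+y] : ∀ y x u → y + (x + u) ≡ u + (x + y)
  y+[x+u]≡u+[x+y] = solve-∀

module Digits (d L : ℕ) .{{_ : NonZero d}} .{{_ : NonZero L}} where

  low mid high : ℕ → ℕ
  low  x = x % d
  mid  x = (x / d) % L
  high x = (x / d) / L

  low< : ∀ x → low x < d
  low< x = m%n<n x d

  mid< : ∀ x → mid x < L
  mid< x = m%n<n (x / d) L

  high< : ∀ {c} x → x < c * (d * L) → high x < c
  high< {c} x x< = m<n*o⇒m/o<n (m<n*o⇒m/o<n (subst (x <_) (c*[d*L]≡c*L*d c d L) x<))
    where
    c*[d*L]≡c*L*d : ∀ c d L → c * (d * L) ≡ c * L * d
    c*[d*L]≡c*L*d = solve-∀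

  decompose : ∀ x → x ≡ high x * (d * L) + (mid x * d + low x)
  decompose x = begin
    x                                          ≡⟨ m≡m%n+[m/n]*n x d ⟩
    low x + (x / d) * d                        ≡⟨ cong (λ y → low x + y * d) (m≡m%n+[m/n]*n (x / d) L) ⟩
    low x + (mid x + high x * L) * d           ≡⟨ regroup (high x) (mid x) (low x) d L ⟩
    high x * (d * L) + (mid x * d + low x)     ∎
    where
    open ≡-Reasoning
    regroup : ∀ a p r d L → r + (p + a * L) * d ≡ a * (d * L) + (p * d + r)
    regroup = solve-∀

  digits-determine : ∀ {x y} → high x ≡ high y → mid x ≡ mid y → low x ≡ low y → x ≡ y
  digits-determine {x} {y} a≡ p≡ r≡ =
    trans (decompose x) (trans (cong₂ (λ a t → a * (d * L) + t) a≡ (cong₂ (λ p r → p * d + r) p≡ r≡)) (sym (decompose y)))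

  digits₃-of : ∀ a {p r} → p < L → r < d →
    high (a * (d * L) + (p * d + r)) ≡ a × mid (a * (d * L) + (p * d + r)) ≡ p × low (a * (d * L) + (p * d + r)) ≡ r
  digits₃-of a {p} {r} p<L r<d =
    trans (cong (λ y → y / L) x/d≡aL+p) (proj₁ aL+p-digits) ,
    trans (cong (λ y → y % L) x/d≡aL+p) (proj₂ aL+p-digits) ,
    trans (cong (_% d) regroup) (proj₂ (digits-of (a * L + p) r d r<d))
    where
    regroup-law : ∀ a p r d L → a * (d * L) + (p * d + r) ≡ (a * L + p) * d + r
    regroup-law = solve-∀
    regroup : a * (d * L) + (p * d + r) ≡ (a * L + p) * d + r
    regroup = regroup-law a p r d L
    x/d≡aL+p : (a * (d * L) + (p * d + r)) / d ≡ a * L + p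
    x/d≡aL+p = trans (cong (_/ d) regroup) (proj₁ (digits-of (a * L + p) r d r<d))
    aL+p-digits = digits-of a p L p<L

data EvenOrOdd (n : ℕ) : Set where
  even : ∀ h → h * 2 ≡ n → EvenOrOdd n
  odd  : ∀ h → suc (h * 2) ≡ n → EvenOrOdd n

evenOrOdd : ∀ n → EvenOrOdd n
evenOrOdd zero = even 0 refl
evenOrOdd (suc n) with evenOrOdd n
... | even h eq = odd h (cong suc eq)
... | odd  h eq = even (suc h) (cong suc eq)

n+n≡n*2 : ∀ n → n + n ≡ n * 2
n+n≡n*2 n = trans (cong (n +_) (sym (+-identityʳ n))) (*-comm 2 n)

-- Arrays filled along cyclic diagonals

injective⇒surjective : ∀ {n} (f : Fin n → Fin n) → (∀ {x y} → f x ≡ f y → x ≡ y) → ∀ y → ∃ λ x → f x ≡ y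
injective⇒surjective {suc n} f f-inj y with any? (λ x → f x ≟ᶠ y)
... | yes hit = hit
... | no miss = ⊥-elim (no-collision (pigeonhole (n<1+n n) g))
  where
  y≢f : ∀ x → y ≢ f x
  y≢f x y≡fx = miss (x , sym y≡fx)
  g : Fin (suc n) → Fin n
  g x = punchOut (y≢f x)
  no-collision : ∃₂ (λ i j → toℕ i < toℕ j × g i ≡ g j) → ⊥
  no-collision (i , j , i<j , same) = <-irrefl (cong toℕ (f-inj (punchOut-injective (y≢f i) (y≢f j) same))) i<j

nonzero-injection-onto : ∀ T (F : ℕ → Fin (suc T)) →
  (∀ {t} → t < T → toℕ (F t) ≢ 0) →
  (∀ {t t′} → t < T → t′ < T → F t ≡ F t′ → t ≡ t′) →
  ∀ x → toℕ x ≢ 0 → ∃ λ t → t < T × F t ≡ x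
nonzero-injection-onto T F F≢0 F-inj x x≢0 =
  toℕ i , toℕ<n i , punchOut-injective (0≢ (F≢0 (toℕ<n i))) (0≢ x≢0) (proj₂ preimage)
  where
  0≢ : ∀ {y : Fin (suc T)} → toℕ y ≢ 0 → Fin.zero ≢ y
  0≢ y≢0 0≡y = y≢0 (cong toℕ (sym 0≡y))
  f : Fin T → Fin T
  f i = punchOut (0≢ (F≢0 (toℕ<n i)))
  f-inj : ∀ {i j} → f i ≡ f j → i ≡ j
  f-inj {i} {j} fi≡fj =
    toℕ-injective (F-inj (toℕ<n i) (toℕ<n j) (punchOut-injective (0≢ (F≢0 (toℕ<n i))) (0≢ (F≢0 (toℕ<n j))) fi≡fj))
  preimage : ∃ λ i → f i ≡ punchOut (0≢ x≢0)
  preimage = injective⇒surjective f f-inj (punchOut (0≢ x≢0))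
  i : Fin T
  i = proj₁ preimage

record ZeroSumSequence (m n s k c : ℕ) : Set where
  field
    entry : ℕ → Fin (suc (n * k * c))
    entry≢0 : ∀ {t} → t < n * k * c → toℕ (entry t) ≢ 0
    entry-injective : ∀ {t t′} → t < n * k * c → t′ < n * k * c → entry t ≡ entry t′ → t ≡ t′
    row-sum : ∀ {a i} → a < c → i < m →
      ∑[ u < s ] toℕ (entry (a * (n * k) + (i * s + u))) % suc (n * k * c) ≡ 0
    column-sum : ∀ {a j} → a < c → j < n →
      ∑[ l < k ] toℕ (entry (a * (n * k) + (l * n + j))) % suc (n * k * c) ≡ 0

-- Read row by row, the filled cells of array a carry the entries a n k, …, a n k + n k − 1 in order.
module DiagonalLayout {m n s k c : ℕ} .{{_ : NonZero m}} .{{_ : NonZero n}} .{{_ : NonZero s}}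
  (s≤n : s ≤ n) (ms≡nk : m * s ≡ n * k) (Z : ZeroSumSequence m n s k c) where

  open ZeroSumSequence Z

  T : ℕ
  T = n * k * c

  offset : ℕ → ℕ → ℕ
  offset i j = subMod n j (i * s)

  position : ℕ → ℕ → ℕ → ℕ
  position a i u = a * (n * k) + (i * s + u)

  cell : ℕ → ℕ → ℕ → Maybe (Fin (suc T))
  cell a i j with offset i j <? s
  ... | yes _ = just (entry (position a i (offset i j)))
  ... | no  _ = nothing

  array : Fin c → PArray (suc T) m n
  array a i j = cell (toℕ a) (toℕ i) (toℕ j)

  position-< : ∀ {a i u} → a < c → i < m → u < s → position a i u < T
  position-< {a} {i} {u} a<c i<m u<s = subst (position a i u <_) (*-comm c (n * k))
    (digit-bound a<c (subst (i * s + u <_) ms≡nk (digit-bound i<m u<s)))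

  position-injective : ∀ {a i u a′ i′ u′} → i < m → u < s → i′ < m → u′ < s →
    position a i u ≡ position a′ i′ u′ → a ≡ a′ × i ≡ i′ × u ≡ u′
  position-injective {a} {i} {u} {a′} {i′} {u′} i<m u<s i′<m u′<s eq =
    proj₁ outer , proj₁ inner , proj₂ inner
    where
    instance
      nk≢0 : NonZero (n * k)
      nk≢0 = subst NonZero ms≡nk (m*n≢0 m s)
    outer = digits-injective (n * k) (subst (i * s + u <_) ms≡nk (digit-bound i<m u<s))
                                     (subst (i′ * s + u′ <_) ms≡nk (digit-bound i′<m u′<s)) eq
    inner = digits-injective s u<s u′<s (proj₂ outer)

  on-diagonal : ∀ i {j u} → j < n → u < n → (j ≡ (i * s + u) % n) ⇔ (u ≡ offset i j)
  on-diagonal i {j} {u} j<n u<n = mk⇔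
    (λ j≡ → sym (trans (cong (λ v → subMod n v (i * s)) j≡) (subMod-unique (i * s) n u<n)))
    (λ u≡ → sym (trans (cong (λ v → (i * s + v) % n) u≡) (+-subMod (i * s) n j<n)))

  -- Writing a cell as a sum over the s positions of its row turns row and column sums into double sums.
  cell-weight : ∀ (g : Maybe (Fin (suc T)) → ℕ) → g nothing ≡ 0 → ∀ a i {j} → j < n →
    g (cell a i j) ≡ ∑[ u < s ] when (j ≟ (i * s + u) % n) (g (just (entry (position a i u))))
  cell-weight g g-nothing a i {j} j<n = trans selected (sym (∑-cong s (λ u u<s →
      when-cong (on-diagonal i j<n (≤-trans u<s s≤n)) (j ≟ _) (u ≟ offset i j) (G u))))
    where
    G : ℕ → ℕ
    G u = g (just (entry (position a i u)))
    selected : g (cell a i j) ≡ ∑[ u < s ] when (u ≟ offset i j) (G u)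
    selected with offset i j <? s
    ... | yes o<s = sym (∑-when-≡ s (offset i j) G o<s)
    ... | no  o≮s = trans g-nothing (sym (∑-when-≡-out s (offset i j) G (≮⇒≥ o≮s)))

  row-weight : ∀ (g : Maybe (Fin (suc T)) → ℕ) → g nothing ≡ 0 → ∀ a i →
    ∑[ j < n ] g (cell a i j) ≡ ∑[ u < s ] g (just (entry (position a i u)))
  row-weight g g-nothing a i = begin
    ∑[ j < n ] g (cell a i j)                          ≡⟨ ∑-cong n (λ j j<n → cell-weight g g-nothing a i j<n) ⟩
    ∑[ j < n ] ∑[ u < s ] when (j ≟ (i * s + u) % n) (G u) ≡⟨ ∑-comm n s _ ⟩
    ∑[ u < s ] ∑[ j < n ] when (j ≟ (i * s + u) % n) (G u) ≡⟨ ∑-cong s (λ u _ → ∑-when-≡ n _ (λ _ → G u) (m%n<n _ n)) ⟩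
    ∑[ u < s ] G u                                     ∎
    where
    open ≡-Reasoning
    G : ℕ → ℕ
    G u = g (just (entry (position a i u)))

  column-weight : ∀ (g : Maybe (Fin (suc T)) → ℕ) → g nothing ≡ 0 → ∀ a {j} → j < n →
    ∑[ i < m ] g (cell a i j) ≡ ∑[ l < k ] g (just (entry (a * (n * k) + (l * n + j))))
  column-weight g g-nothing a {j} j<n = begin
    ∑[ i < m ] g (cell a i j)                     ≡⟨ ∑-cong m (λ i _ → cell-weight g g-nothing a i j<n) ⟩
    ∑[ i < m ] ∑[ u < s ] H (i * s + u)           ≡⟨ ∑-* m s H ⟨
    ∑ (m * s) H                                   ≡⟨ cong (λ b → ∑ b H) (trans ms≡nk (*-comm n k)) ⟩
    ∑ (k * n) H                                   ≡⟨ ∑-* k n H ⟩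
    ∑[ l < k ] ∑[ j′ < n ] H (l * n + j′)         ≡⟨ ∑-cong k (λ l _ → ∑-cong n (λ j′ j′<n →
                                                       when-cong (mk⇔ (λ eq → trans eq (column≡ l j′<n)) (λ eq → trans eq (sym (column≡ l j′<n))))
                                                         (j ≟ _) (j ≟ j′) _)) ⟩
    ∑[ l < k ] ∑[ j′ < n ] when (j ≟ j′) (G (l * n + j′)) ≡⟨ ∑-cong k (λ l _ → ∑-cong n (λ j′ _ →
                                                       when-cong (mk⇔ sym sym) (j ≟ j′) (j′ ≟ j) _)) ⟩
    ∑[ l < k ] ∑[ j′ < n ] when (j′ ≟ j) (G (l * n + j′)) ≡⟨ ∑-cong k (λ l _ → ∑-when-≡ n j (λ j′ → G (l * n + j′)) j<n) ⟩
    ∑[ l < k ] G (l * n + j)                      ∎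
    where
    open ≡-Reasoning
    G : ℕ → ℕ
    G t = g (just (entry (a * (n * k) + t)))
    H : ℕ → ℕ
    H t = when (j ≟ t % n) (G t)
    column≡ : ∀ l {j′} → j′ < n → (l * n + j′) % n ≡ j′
    column≡ l j′<n = proj₂ (digits-of l _ n j′<n)

  cell-filled : ∀ a i j → offset i j < s → cell a i j ≡ just (entry (position a i (offset i j)))
  cell-filled a i j o<s with offset i j <? s
  ... | yes _   = refl
  ... | no  o≮s = contradiction o<s o≮s

  cell-entry : ∀ {a i j x} → cell a i j ≡ just x → offset i j < s × entry (position a i (offset i j)) ≡ x
  cell-entry {a} {i} {j} eq with offset i j <? s
  cell-entry refl | yes o<s = o<s , refl
  cell-entry ()   | no  _

  entries≢0 : ∀ a i j (x : Fin (suc T)) → array a i j ≡ just x → toℕ x ≢ 0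
  entries≢0 a i j x eq with cell-entry eq
  ... | o<s , refl = entry≢0 (position-< (toℕ<n a) (toℕ<n i) o<s)

  entries-distinct : ∀ a i j a′ i′ j′ (x : Fin (suc T)) → array a i j ≡ just x → array a′ i′ j′ ≡ just x →
    a ≡ a′ × i ≡ i′ × j ≡ j′
  entries-distinct a i j a′ i′ j′ x eq eq′ with cell-entry eq | cell-entry eq′
  ... | o<s , refl | o′<s , e′ = toℕ-injective (proj₁ same) , toℕ-injective (proj₁ (proj₂ same)) ,
    toℕ-injective (begin
      toℕ j                                         ≡⟨ +-subMod (toℕ i * s) n (toℕ<n j) ⟨
      (toℕ i * s + offset (toℕ i) (toℕ j)) % n       ≡⟨ cong₂ (λ i u → (i * s + u) % n) (proj₁ (proj₂ same)) (proj₂ (proj₂ same)) ⟩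
      (toℕ i′ * s + offset (toℕ i′) (toℕ j′)) % n    ≡⟨ +-subMod (toℕ i′ * s) n (toℕ<n j′) ⟩
      toℕ j′                                        ∎)
    where
    open ≡-Reasoning
    same = position-injective (toℕ<n i) o<s (toℕ<n i′) o′<s
             (entry-injective (position-< (toℕ<n a) (toℕ<n i) o<s) (position-< (toℕ<n a′) (toℕ<n i′) o′<s) (sym e′))

  entries-cover : ∀ (x : Fin (suc T)) → toℕ x ≢ 0 → Σ (Fin c) λ a → Σ (Fin m) λ i → Σ (Fin n) λ j → array a i j ≡ just x
  entries-cover x x≢0 with nonzero-injection-onto T entry entry≢0 entry-injective x x≢0
  ... | t , t<T , entry-t≡x = fromℕ< a<c , fromℕ< i<m , fromℕ< j<n , (begin
    cell (toℕ (fromℕ< a<c)) (toℕ (fromℕ< i<m)) (toℕ (fromℕ< j<n)) ≡⟨ cong₂ (λ (a , i) j → cell a i j)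
                                                                  (cong₂ _,_ (toℕ-fromℕ< a<c) (toℕ-fromℕ< i<m)) (toℕ-fromℕ< j<n) ⟩
    cell a i j                                                ≡⟨ cell-filled a i j (subst (_< s) (sym offset≡u) u<s) ⟩
    just (entry (position a i (offset i j)))                   ≡⟨ cong (λ v → just (entry (position a i v))) offset≡u ⟩
    just (entry (position a i u))                             ≡⟨ cong (just ∘ entry) position≡t ⟩
    just (entry t)                                            ≡⟨ cong just entry-t≡x ⟩
    just x                                                    ∎)
    where
    open ≡-Reasoning
    open Digits s m
    nk≡s*m : n * k ≡ s * m
    nk≡s*m = trans (sym ms≡nk) (*-comm m s)
    a i u j : ℕ
    a = high t
    i = mid t
    u = low t
    j = (i * s + u) % n
    a<c : a < c
    a<c = high< t (subst (t <_) (trans (*-comm (n * k) c) (cong (c *_) nk≡s*m)) t<T)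
    i<m : i < m
    i<m = mid< t
    u<s : u < s
    u<s = low< t
    j<n : j < n
    j<n = m%n<n _ n
    offset≡u : offset i j ≡ u
    offset≡u = subMod-unique (i * s) n (≤-trans u<s s≤n)
    position≡t : position a i u ≡ t
    position≡t = trans (cong (λ b → a * b + (i * s + u)) nk≡s*m) (sym (decompose t))

  row-counts : ∀ a i → rowCount (array a) i ≡ s
  row-counts a i = begin
    rowCount (array a) i                         ≡⟨ Σ<≡∑ n _ (λ j → filled (cell (toℕ a) (toℕ i) j)) (λ _ → refl) ⟩
    ∑[ j < n ] filled (cell (toℕ a) (toℕ i) j)   ≡⟨ row-weight filled refl (toℕ a) (toℕ i) ⟩
    ∑[ _ < s ] 1                                 ≡⟨ trans (∑-const s 1) (*-identityʳ s) ⟩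
    s                                            ∎
    where open ≡-Reasoning

  column-counts : ∀ a j → colCount (array a) j ≡ k
  column-counts a j = begin
    colCount (array a) j                         ≡⟨ Σ<≡∑ m _ (λ i → filled (cell (toℕ a) i (toℕ j))) (λ _ → refl) ⟩
    ∑[ i < m ] filled (cell (toℕ a) i (toℕ j))   ≡⟨ column-weight filled refl (toℕ a) (toℕ<n j) ⟩
    ∑[ _ < k ] 1                                 ≡⟨ trans (∑-const k 1) (*-identityʳ k) ⟩
    k                                            ∎
    where open ≡-Reasoning

  row-sums : ∀ a i → rowSum T (array a) i ≡ 0
  row-sums a i = trans (cong (_% suc T) (trans (Σ<≡∑ n _ (λ j → val (cell (toℕ a) (toℕ i) j)) (λ _ → refl))
                                               (row-weight val refl (toℕ a) (toℕ i))))
                       (row-sum (toℕ<n a) (toℕ<n i))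

  column-sums : ∀ a j → colSum T (array a) j ≡ 0
  column-sums a j = trans (cong (_% suc T) (trans (Σ<≡∑ m _ (λ i → val (cell (toℕ a) i (toℕ j))) (λ _ → refl))
                                                  (column-weight val refl (toℕ a) (toℕ<n j))))
                          (column-sum (toℕ<n a) (toℕ<n j))

  M0S : M0S-exists m n s k c
  M0S = array , entries≢0 , entries-cover , entries-distinct , row-counts , column-counts , row-sums , column-sums

-- Signed residues and paired sequences

positive negative : ℕ → (ℕ → Bool) → (ℕ → ℕ) → ℕ
positive L b x = ∑[ l < L ] (if b l then x l else 0)
negative L b x = ∑[ l < L ] (if b l then 0 else x l)

#negative : ℕ → (ℕ → Bool) → ℕ
#negative L b = ∑[ l < L ] (if b l then 0 else 1)

positive-cong : ∀ L {b b′ x y} → (∀ l → l < L → b l ≡ b′ l) → (∀ l → l < L → x l ≡ y l) → positive L b x ≡ positive L b′ y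
positive-cong L b≡ x≡ = ∑-cong L (λ l l<L → cong₂ (λ c v → if c then v else 0) (b≡ l l<L) (x≡ l l<L))

negative-cong : ∀ L {b b′ x y} → (∀ l → l < L → b l ≡ b′ l) → (∀ l → l < L → x l ≡ y l) → negative L b x ≡ negative L b′ y
negative-cong L b≡ x≡ = ∑-cong L (λ l l<L → cong₂ (λ c v → if c then 0 else v) (b≡ l l<L) (x≡ l l<L))

positive-+ : ∀ L L′ b x → positive (L + L′) b x ≡ positive L b x + positive L′ (λ i → b (L + i)) (λ i → x (L + i))
positive-+ L L′ b x = ∑-+ L L′ _

negative-+ : ∀ L L′ b x → negative (L + L′) b x ≡ negative L b x + negative L′ (λ i → b (L + i)) (λ i → x (L + i))
negative-+ L L′ b x = ∑-+ L L′ _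

positive-not : ∀ L b x → positive L (not ∘ b) x ≡ negative L b x
positive-not L b x = ∑-cong L (λ l _ → if-not (b l))

negative-not : ∀ L b x → negative L (not ∘ b) x ≡ positive L b x
negative-not L b x = ∑-cong L (λ l _ → if-not (b l))

#negative-+-not : ∀ L b → #negative L b + #negative L (not ∘ b) ≡ L
#negative-+-not L b = begin
  #negative L b + #negative L (not ∘ b)                      ≡⟨ ∑-distrib-+ L _ _ ⟨
  ∑[ l < L ] ((if b l then 0 else 1) + (if not (b l) then 0 else 1)) ≡⟨ ∑-cong L (λ l _ → one (b l)) ⟩
  ∑[ l < L ] 1                                               ≡⟨ trans (∑-const L 1) (*-identityʳ L) ⟩
  L                                                          ∎
  where
  open ≡-Reasoning
  one : ∀ c → (if c then 0 else 1) + (if not c then 0 else 1) ≡ 1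
  one true  = refl
  one false = refl

module SignedResidues (T M : ℕ) (T≡M*2 : T ≡ M * 2) where

  P : ℕ
  P = suc T

  -- signed true x and signed false x are the residues of x and −x modulo P.
  signed : Bool → ℕ → ℕ
  signed true  x = x
  signed false x = P ∸ x

  +-<P : ∀ {x x′} → x ≤ M → x′ ≤ M → x + x′ < P
  +-<P {x} {x′} x≤M x′≤M = s≤s (subst (x + x′ ≤_) (sym (trans T≡M*2 (trans (*-comm M 2) (cong (M +_) (+-identityʳ M))))) (+-mono-≤ x≤M x′≤M))

  M<P : M < P
  M<P = subst (_< P) (+-identityʳ M) (+-<P ≤-refl z≤n)

  signed-range : ∀ b {x} → 1 ≤ x → x ≤ M → 1 ≤ signed b x × signed b x < P
  signed-range true  1≤x x≤M = 1≤x , ≤-<-trans x≤M M<P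
  signed-range false 1≤x x≤M = m<n⇒0<n∸m (≤-<-trans x≤M M<P) , ∸-monoʳ-< 1≤x (<⇒≤ (≤-<-trans x≤M M<P))

  signed-+-not : ∀ b {x} → x ≤ P → signed b x + signed (not b) x ≡ P
  signed-+-not true  x≤P = m+[n∸m]≡n x≤P
  signed-+-not false x≤P = m∸n+n≡m x≤P

  signed-injective : ∀ b b′ {x x′} → x ≤ M → x′ ≤ M → signed b x ≡ signed b′ x′ → b ≡ b′ × x ≡ x′
  signed-injective true  true  _   _    eq = refl , eq
  signed-injective false false x≤M x′≤M eq = refl , ∸-cancelˡ-≡ (<⇒≤ (≤-<-trans x≤M M<P)) (<⇒≤ (≤-<-trans x′≤M M<P)) eq
  signed-injective true  false x≤M x′≤M eq = ⊥-elim (no-wrap x≤M x′≤M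
    (trans (cong (_+ _) eq) (m∸n+n≡m (<⇒≤ (≤-<-trans x′≤M M<P)))))
    where
    no-wrap : ∀ {x x′} → x ≤ M → x′ ≤ M → x + x′ ≢ P
    no-wrap x≤M x′≤M eq = <-irrefl eq (+-<P x≤M x′≤M)
  signed-injective false true x≤M x′≤M eq = Product.map sym sym (signed-injective true false x′≤M x≤M (sym eq))

  ∑-signed : ∀ L b x → (∀ l → l < L → x l ≤ P) →
    ∑[ l < L ] signed (b l) (x l) + negative L b x ≡ #negative L b * P + positive L b x
  ∑-signed L b x x≤P = begin
    ∑[ l < L ] signed (b l) (x l) + negative L b x                   ≡⟨ ∑-distrib-+ L _ _ ⟨
    ∑[ l < L ] (signed (b l) (x l) + (if b l then 0 else x l))       ≡⟨ ∑-cong L (λ l l<L → pointwise (b l) (x≤P l l<L)) ⟩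
    ∑[ l < L ] ((if b l then 0 else 1) * P + (if b l then x l else 0)) ≡⟨ ∑-distrib-+ L _ _ ⟩
    ∑[ l < L ] ((if b l then 0 else 1) * P) + positive L b x          ≡⟨ cong (_+ positive L b x) (∑-distribʳ-* L _ P) ⟩
    #negative L b * P + positive L b x                                ∎
    where
    open ≡-Reasoning
    pointwise : ∀ b {y} → y ≤ P → signed b y + (if b then 0 else y) ≡ (if b then 0 else 1) * P + (if b then y else 0)
    pointwise true  _   = +-identityʳ _
    pointwise false y≤P = trans (m∸n+n≡m y≤P) (sym (trans (+-identityʳ (1 * P)) (*-identityˡ P)))

  ∑-signed-≡0 : ∀ L b x z → (∀ l → l < L → x l ≤ P) → positive L b x ≡ negative L b x + z * P →
    (∑[ l < L ] signed (b l) (x l)) % P ≡ 0 × (∑[ l < L ] signed (not (b l)) (x l)) % P ≡ 0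
  ∑-signed-≡0 L b x z x≤P balanced =
    trans (cong (_% P) S≡) (m*n%n≡0 (#negative L b + z) P) ,
    trans (sym ([m+kn]%n≡m%n S′ z P)) (trans (cong (_% P) S′≡) (m*n%n≡0 (#negative L (not ∘ b)) P))
    where
    S S′ N : ℕ
    S  = ∑[ l < L ] signed (b l) (x l)
    S′ = ∑[ l < L ] signed (not (b l)) (x l)
    N  = negative L b x
    regroup₁ : ∀ C P N z → C * P + (N + z * P) ≡ (C + z) * P + N
    regroup₁ = solve-∀
    regroup₂ : ∀ S N z P → S + (N + z * P) ≡ (S + z * P) + N
    regroup₂ = solve-∀
    S≡ : S ≡ (#negative L b + z) * P
    S≡ = +-cancelʳ-≡ N _ _ (trans (∑-signed L b x x≤P)
           (trans (cong (#negative L b * P +_) balanced) (regroup₁ (#negative L b) P N z)))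
    S′≡ : S′ + z * P ≡ #negative L (not ∘ b) * P
    S′≡ = +-cancelʳ-≡ N _ _ (begin
      (S′ + z * P) + N                                 ≡⟨ regroup₂ S′ N z P ⟨
      S′ + (N + z * P)                                 ≡⟨ cong (S′ +_) balanced ⟨
      S′ + positive L b x                              ≡⟨ cong (S′ +_) (negative-not L b x) ⟨
      S′ + negative L (not ∘ b) x                      ≡⟨ ∑-signed L (not ∘ b) x x≤P ⟩
      #negative L (not ∘ b) * P + positive L (not ∘ b) x ≡⟨ cong (_ +_) (positive-not L b x) ⟩
      #negative L (not ∘ b) * P + N                    ∎)
      where open ≡-Reasoning

  -- Equal offsets D and E mean that the signed sums of x and of y are equal as integers.
  ∑-signed-complementary : ∀ L b x y D E → (∀ l → l < L → x l ≤ P) → (∀ l → l < L → y l ≤ P) →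
    positive L b x + D ≡ negative L b x + E → positive L b y + D ≡ negative L b y + E →
    ∑[ l < L ] signed (b l) (x l) + ∑[ l < L ] signed (not (b l)) (y l) ≡ L * P
  ∑-signed-complementary L b x y D E x≤P y≤P x-balance y-balance = +-cancelʳ-≡ (negative L b x + positive L b y) _ _ (begin
    (S + S′) + (negative L b x + positive L b y)           ≡⟨ interchange S S′ _ _ ⟩
    (S + negative L b x) + (S′ + positive L b y)           ≡⟨ cong₂ _+_ (∑-signed L b x x≤P) S′-identity ⟩
    (C * P + positive L b x) + (C′ * P + negative L b y)   ≡⟨ interchange (C * P) _ _ _ ⟩
    (C * P + C′ * P) + (positive L b x + negative L b y)   ≡⟨ cong₂ _+_ (trans (sym (*-distribʳ-+ P C C′)) (cong (_* P) (#negative-+-not L b))) balanced ⟩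
    L * P + (negative L b x + positive L b y)              ∎)
    where
    open ≡-Reasoning
    S S′ C C′ : ℕ
    S  = ∑[ l < L ] signed (b l) (x l)
    S′ = ∑[ l < L ] signed (not (b l)) (y l)
    C  = #negative L b
    C′ = #negative L (not ∘ b)
    balanced : positive L b x + negative L b y ≡ negative L b x + positive L b y
    balanced = +-cancelʳ-≡ (D + E) _ _ (begin
      (positive L b x + negative L b y) + (D + E) ≡⟨ interchange (positive L b x) _ D E ⟩
      (positive L b x + D) + (negative L b y + E) ≡⟨ cong₂ _+_ x-balance (sym y-balance) ⟩
      (negative L b x + E) + (positive L b y + D) ≡⟨ interchange (negative L b x) E _ D ⟩
      (negative L b x + positive L b y) + (E + D) ≡⟨ cong (negative L b x + positive L b y +_) (+-comm E D) ⟩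
      (negative L b x + positive L b y) + (D + E) ∎)
    S′-identity : S′ + positive L b y ≡ C′ * P + negative L b y
    S′-identity = begin
      S′ + positive L b y                     ≡⟨ cong (S′ +_) (negative-not L b y) ⟨
      S′ + negative L (not ∘ b) y             ≡⟨ ∑-signed L (not ∘ b) y y≤P ⟩
      C′ * P + positive L (not ∘ b) y         ≡⟨ cong (C′ * P +_) (positive-not L b y) ⟩
      C′ * P + negative L b y                 ∎

record Labelling (M : ℕ) : Set where
  field
    mag  : ℕ → ℕ
    sign : ℕ → Bool
    mag-range     : ∀ {x} → x < M → 1 ≤ mag x × mag x ≤ M
    mag-injective : ∀ {x y} → x < M → y < M → mag x ≡ mag y → x ≡ y

-- Entries 2x and 2x + 1 of the sequence are the residues of ±mag x, with opposite signs.
module PairSequence {T M : ℕ} (T≡M*2 : T ≡ M * 2) (Λ : Labelling M) where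

  open SignedResidues T M T≡M*2
  open Labelling Λ

  flipIf : ℕ → Bool → Bool
  flipIf zero    b = b
  flipIf (suc _) b = not b

  value : ℕ → ℕ
  value t = signed (flipIf (t % 2) (sign (t / 2))) (mag (t / 2))

  value-even : ∀ x → value (x * 2) ≡ signed (sign x) (mag x)
  value-even x = cong₂ (λ r q → signed (flipIf r (sign q)) (mag q)) (m*n%n≡0 x 2) (m*n/n≡m x 2)

  value-odd : ∀ x → value (suc (x * 2)) ≡ signed (not (sign x)) (mag x)
  value-odd x = cong₂ (λ r q → signed (flipIf r (sign q)) (mag q)) (proj₂ digits) (proj₁ digits)
    where
    digits : suc (x * 2) / 2 ≡ x × suc (x * 2) % 2 ≡ 1
    digits = subst (λ t → t / 2 ≡ x × t % 2 ≡ 1) (+-comm (x * 2) 1) (digits-of x 1 2 (s≤s (s≤s z≤n)))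

  half< : ∀ {t} → t < T → t / 2 < M
  half< {t} t<T = m<n*o⇒m/o<n (subst (t <_) T≡M*2 t<T)

  value-range : ∀ {t} → t < T → 1 ≤ value t × value t < P
  value-range {t} t<T = signed-range (flipIf (t % 2) (sign (t / 2))) (proj₁ (mag-range (half< t<T))) (proj₂ (mag-range (half< t<T)))

  value-injective : ∀ {t t′} → t < T → t′ < T → value t ≡ value t′ → t ≡ t′
  value-injective {t} {t′} t<T t′<T eq = begin
    t                    ≡⟨ m≡m%n+[m/n]*n t 2 ⟩
    t % 2 + t / 2 * 2    ≡⟨ cong₂ (λ r q → r + q * 2) (flipIf-injective (m%n<n t 2) (m%n<n t′ 2) flips≡) halves≡ ⟩
    t′ % 2 + t′ / 2 * 2  ≡⟨ m≡m%n+[m/n]*n t′ 2 ⟨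
    t′                   ∎
    where
    open ≡-Reasoning
    parts = signed-injective _ _ (proj₂ (mag-range (half< t<T))) (proj₂ (mag-range (half< t′<T))) eq
    halves≡ : t / 2 ≡ t′ / 2
    halves≡ = mag-injective (half< t<T) (half< t′<T) (proj₂ parts)
    flips≡ : flipIf (t % 2) (sign (t / 2)) ≡ flipIf (t′ % 2) (sign (t / 2))
    flips≡ = trans (proj₁ parts) (cong (λ q → flipIf (t′ % 2) (sign q)) (sym halves≡))
    flipIf-injective : ∀ {r r′ b} → r < 2 → r′ < 2 → flipIf r b ≡ flipIf r′ b → r ≡ r′
    flipIf-injective {0}     {0}     _ _ _ = refl
    flipIf-injective {1}     {1}     _ _ _ = refl
    flipIf-injective {0}     {1}     _ _ b≡¬b = ⊥-elim (not-¬ refl b≡¬b)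
    flipIf-injective {1}     {0}     _ _ ¬b≡b = ⊥-elim (not-¬ refl (sym ¬b≡b))
    flipIf-injective {suc (suc _)} (s≤s (s≤s ())) _ _
    flipIf-injective {_} {suc (suc _)} _ (s≤s (s≤s ())) _

  ∑-value-pairs : ∀ y L → y + L ≤ M → ∑[ u < L * 2 ] value (y * 2 + u) ≡ L * P
  ∑-value-pairs y L y+L≤M = begin
    ∑[ u < L * 2 ] value (y * 2 + u)                                      ≡⟨ ∑-pairs L _ ⟩
    ∑[ p < L ] (value (y * 2 + p * 2) + value (y * 2 + suc (p * 2)))      ≡⟨ ∑-cong L pair-sum ⟩
    ∑[ _ < L ] P                                                          ≡⟨ ∑-const L P ⟩
    L * P                                                                 ∎
    where
    open ≡-Reasoning
    pair-sum : ∀ p → p < L → value (y * 2 + p * 2) + value (y * 2 + suc (p * 2)) ≡ P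
    pair-sum p p<L = begin
      value (y * 2 + p * 2) + value (y * 2 + suc (p * 2))
        ≡⟨ cong₂ (λ t t′ → value t + value t′) (sym (*-distribʳ-+ 2 y p)) (trans (+-suc (y * 2) (p * 2)) (cong suc (sym (*-distribʳ-+ 2 y p)))) ⟩
      value ((y + p) * 2) + value (suc ((y + p) * 2))
        ≡⟨ cong₂ _+_ (value-even (y + p)) (value-odd (y + p)) ⟩
      signed (sign (y + p)) (mag (y + p)) + signed (not (sign (y + p))) (mag (y + p))
        ≡⟨ signed-+-not (sign (y + p)) (<⇒≤ (≤-<-trans (proj₂ (mag-range y+p<M)) M<P)) ⟩
      P ∎
      where
      y+p<M : y + p < M
      y+p<M = <-≤-trans (+-monoʳ-< y p<L) y+L≤M

paired-size : ∀ n h c → n * (h * 2) * c ≡ n * h * c * 2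
paired-size = solve-∀

module PairedArrays {m n s₂ h c : ℕ} .{{_ : NonZero m}} .{{_ : NonZero n}} .{{_ : NonZero s₂}}
  (s≤n : s₂ * 2 ≤ n) (ms≡nk : m * (s₂ * 2) ≡ n * (h * 2)) (Λ : Labelling (n * h * c)) where

  open SignedResidues (n * (h * 2) * c) (n * h * c) (paired-size n h c) public
  open PairSequence (paired-size n h c) Λ public

  entry : ℕ → Fin P
  entry t = fromℕ< (m%n<n (value t) P)

  ∑-entry-% : ∀ L (f : ℕ → ℕ) → (∑[ l < L ] toℕ (entry (f l))) % P ≡ (∑[ l < L ] value (f l)) % P
  ∑-entry-% L f = trans (cong (_% P) (∑-cong L (λ l _ → toℕ-fromℕ< _))) (∑-% L (value ∘ f) P)

  toℕ-entry : ∀ {t} → t < n * (h * 2) * c → toℕ (entry t) ≡ value t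
  toℕ-entry t<T = trans (toℕ-fromℕ< _) (m<n⇒m%n≡m (proj₂ (value-range t<T)))

  m*s₂≡n*h : m * s₂ ≡ n * h
  m*s₂≡n*h = *-cancelʳ-≡ _ _ 2 (trans (*-assoc m s₂ 2) (trans ms≡nk (sym (*-assoc n h 2))))

  row-fits : ∀ {a i} → a < c → i < m → a * (n * h) + i * s₂ + s₂ ≤ n * h * c
  row-fits {a} {i} a<c i<m = begin
    a * (n * h) + i * s₂ + s₂   ≡⟨ +-assoc (a * (n * h)) (i * s₂) s₂ ⟩
    a * (n * h) + (i * s₂ + s₂) ≡⟨ cong (a * (n * h) +_) (+-comm (i * s₂) s₂) ⟩
    a * (n * h) + suc i * s₂    ≤⟨ +-monoʳ-≤ (a * (n * h)) (*-monoˡ-≤ s₂ i<m) ⟩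
    a * (n * h) + m * s₂        ≡⟨ cong (a * (n * h) +_) m*s₂≡n*h ⟩
    a * (n * h) + n * h         ≡⟨ +-comm (a * (n * h)) (n * h) ⟩
    suc a * (n * h)             ≤⟨ *-monoˡ-≤ (n * h) a<c ⟩
    c * (n * h)                 ≡⟨ *-comm c (n * h) ⟩
    n * h * c                   ∎
    where open ≤-Reasoning

  row-pairs-sum : ∀ {a i} → a < c → i < m →
    ∑[ u < s₂ * 2 ] toℕ (entry (a * (n * (h * 2)) + (i * (s₂ * 2) + u))) % P ≡ 0
  row-pairs-sum {a} {i} a<c i<m = begin
    ∑[ u < s₂ * 2 ] toℕ (entry (a * (n * (h * 2)) + (i * (s₂ * 2) + u))) % P ≡⟨ ∑-entry-% (s₂ * 2) (λ u → a * (n * (h * 2)) + (i * (s₂ * 2) + u)) ⟩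
    ∑[ u < s₂ * 2 ] value (a * (n * (h * 2)) + (i * (s₂ * 2) + u)) % P      ≡⟨ cong (_% P) (∑-cong (s₂ * 2) (λ u _ → cong value (regroup a n h i s₂ u))) ⟩
    ∑[ u < s₂ * 2 ] value ((a * (n * h) + i * s₂) * 2 + u) % P              ≡⟨ cong (_% P) (∑-value-pairs _ s₂ (row-fits a<c i<m)) ⟩
    s₂ * P % P                                                            ≡⟨ m*n%n≡0 s₂ P ⟩
    0                                                                     ∎
    where
    open ≡-Reasoning
    regroup : ∀ a n h i s₂ u → a * (n * (h * 2)) + (i * (s₂ * 2) + u) ≡ (a * (n * h) + i * s₂) * 2 + u
    regroup = solve-∀

  paired-M0S : (∀ {a j} → a < c → j < n → ∑[ l < h * 2 ] value (a * (n * (h * 2)) + (l * n + j)) % P ≡ 0) →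
               M0S-exists m n (s₂ * 2) (h * 2) c
  paired-M0S column-sum = DiagonalLayout.M0S s≤n ms≡nk (record
    { entry           = entry
    ; entry≢0         = λ t<T eq → <-irrefl (sym (trans (sym (toℕ-entry t<T)) eq)) (proj₁ (value-range t<T))
    ; entry-injective = λ t<T t′<T eq → value-injective t<T t′<T
                          (trans (sym (toℕ-entry t<T)) (trans (cong toℕ eq) (toℕ-entry t′<T)))
    ; row-sum         = row-pairs-sum
    ; column-sum      = λ {a} {j} a<c j<n → trans (∑-entry-% (h * 2) (λ l → a * (n * (h * 2)) + (l * n + j))) (column-sum a<c j<n)
    })
    where
    instance
      s≢0 : NonZero (s₂ * 2)
      s≢0 = m*n≢0 s₂ 2

-- An odd number of columns

alternating : ℕ → Bool
alternating zero          = false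
alternating (suc zero)    = true
alternating (suc (suc p)) = alternating p

alternating-even : ∀ v → alternating (v * 2) ≡ false
alternating-even zero    = refl
alternating-even (suc v) = alternating-even v

alternating-odd : ∀ v → alternating (suc (v * 2)) ≡ true
alternating-odd zero    = refl
alternating-odd (suc v) = alternating-odd v

even-half-≤ : ∀ {v q} → v * 2 < suc (q * 2) → v ≤ q
even-half-≤ {v} {q} (s≤s v*2≤q*2) = *-cancelʳ-≤ v q 2 v*2≤q*2

odd-half-< : ∀ {v q} → suc (v * 2) < suc (q * 2) → v < q
odd-half-< {v} {q} (s≤s v*2<q*2) = *-cancelʳ-< 2 v q v*2<q*2

-- h = headRows e + 2w: when h is odd (e = true) its first three rows are treated apart.
headRows : Bool → ℕ
headRows true  = 3
headRows false = 0

rowSign : Bool → ℕ → Bool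
rowSign true  0                   = true
rowSign true  1                   = true
rowSign true  2                   = false
rowSign true  (suc (suc (suc p))) = alternating p
rowSign false p                   = alternating p

alternating-balance : ∀ w d (V : ℕ → ℕ) → (∀ v → V (suc (v * 2)) ≡ V (v * 2) + d) →
  positive (w * 2) alternating V ≡ negative (w * 2) alternating V + w * d
alternating-balance w d V step = begin
  positive (w * 2) alternating V                    ≡⟨ ∑-pairs w _ ⟩
  ∑[ v < w ] (positive-part (v * 2) + positive-part (suc (v * 2))) ≡⟨ ∑-cong w (λ v _ → cong₂ _+_
                                                         (cong (λ b → if b then V (v * 2) else 0) (alternating-even v))
                                                         (trans (cong (λ b → if b then V (suc (v * 2)) else 0) (alternating-odd v)) (step v))) ⟩
  ∑[ v < w ] (0 + (V (v * 2) + d))                  ≡⟨ ∑-distrib-+ w _ _ ⟩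
  ∑[ v < w ] V (v * 2) + ∑[ _ < w ] d               ≡⟨ cong₂ _+_ (∑-cong w (λ v _ → sym (trans (cong₂ _+_
                                                         (cong (λ b → if b then 0 else V (v * 2)) (alternating-even v))
                                                         (cong (λ b → if b then 0 else V (suc (v * 2))) (alternating-odd v)))
                                                         (+-identityʳ (V (v * 2)))))) (∑-const w d) ⟩
  ∑[ v < w ] (negative-part (v * 2) + negative-part (suc (v * 2))) + w * d ≡⟨ cong (_+ w * d) (∑-pairs w _) ⟨
  negative (w * 2) alternating V + w * d            ∎
  where
  open ≡-Reasoning
  positive-part negative-part : ℕ → ℕ
  positive-part p = if alternating p then V p else 0
  negative-part p = if alternating p then 0 else V p

module HalfShift (q : ℕ) where

  n : ℕ
  n = suc (q * 2)

  α β : ℕ → ℕ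
  α zero          = 0
  α (suc zero)    = suc q
  α (suc (suc r)) = suc (α r)
  β zero          = q
  β (suc zero)    = 0
  β (suc (suc r)) = suc (β r)

  α+β : ∀ r → α r + β r ≡ q + r
  α+β zero          = sym (+-identityʳ q)
  α+β (suc zero)    = trans (+-identityʳ (suc q)) (sym (+-comm q 1))
  α+β (suc (suc r)) = begin
    suc (α r) + suc (β r)   ≡⟨ cong suc (+-suc (α r) (β r)) ⟩
    suc (suc (α r + β r))   ≡⟨ cong (suc ∘ suc) (α+β r) ⟩
    suc (suc (q + r))       ≡⟨ sym (trans (+-suc q (suc r)) (cong suc (+-suc q r))) ⟩
    q + suc (suc r)         ∎
    where open ≡-Reasoning

  α-even : ∀ v → α (v * 2) ≡ v
  α-even zero    = refl
  α-even (suc v) = cong suc (α-even v)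

  α-odd : ∀ v → α (suc (v * 2)) ≡ suc (q + v)
  α-odd zero    = cong suc (sym (+-identityʳ q))
  α-odd (suc v) = cong suc (trans (α-odd v) (sym (+-suc q v)))

  β-even : ∀ v → β (v * 2) ≡ q + v
  β-even zero    = sym (+-identityʳ q)
  β-even (suc v) = trans (cong suc (β-even v)) (sym (+-suc q v))

  β-odd : ∀ v → β (suc (v * 2)) ≡ v
  β-odd zero    = refl
  β-odd (suc v) = cong suc (β-odd v)

  α-< : ∀ {r} → r < n → α r < n
  α-< {r} r<n with evenOrOdd r
  ... | even v refl = subst (_< n) (sym (α-even v)) (s≤s (≤-trans (even-half-≤ r<n) (m≤m*n q 2)))
  ... | odd  v refl = subst (_< n) (sym (α-odd v)) (s≤s (subst (q + v <_) (n+n≡n*2 q) (+-monoʳ-< q (odd-half-< r<n))))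

  β-< : ∀ {r} → r < n → β r < n
  β-< {r} r<n with evenOrOdd r
  ... | even v refl = subst (_< n) (sym (β-even v)) (s≤s (subst (q + v ≤_) (n+n≡n*2 q) (+-monoʳ-≤ q (even-half-≤ r<n))))
  ... | odd  v refl = subst (_< n) (sym (β-odd v)) (s≤s (≤-trans (<⇒≤ (odd-half-< r<n)) (m≤m*n q 2)))

  low≢high : ∀ {v v′} → v ≤ q → v ≢ suc (q + v′)
  low≢high v≤q refl = <-irrefl refl (≤-<-trans v≤q (s≤s (m≤m+n q _)))

  high≢low : ∀ {v v′} → v′ < q → q + v ≢ v′
  high≢low v′<q refl = <-irrefl refl (<-≤-trans v′<q (m≤m+n q _))

  α-injective : ∀ {r r′} → r < n → r′ < n → α r ≡ α r′ → r ≡ r′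
  α-injective {r} {r′} r<n r′<n eq with evenOrOdd r | evenOrOdd r′
  ... | even v refl | even v′ refl = cong (_* 2) (trans (sym (α-even v)) (trans eq (α-even v′)))
  ... | odd  v refl | odd  v′ refl =
    cong (λ u → suc (u * 2)) (+-cancelˡ-≡ q _ _ (suc-injective (trans (sym (α-odd v)) (trans eq (α-odd v′)))))
  ... | even v refl | odd  v′ refl = ⊥-elim (low≢high (even-half-≤ r<n) (trans (sym (α-even v)) (trans eq (α-odd v′))))
  ... | odd  v refl | even v′ refl = ⊥-elim (low≢high (even-half-≤ r′<n) (trans (sym (α-even v′)) (trans (sym eq) (α-odd v))))

  β-injective : ∀ {r r′} → r < n → r′ < n → β r ≡ β r′ → r ≡ r′
  β-injective {r} {r′} r<n r′<n eq with evenOrOdd r | evenOrOdd r′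
  ... | even v refl | even v′ refl = cong (_* 2) (+-cancelˡ-≡ q _ _ (trans (sym (β-even v)) (trans eq (β-even v′))))
  ... | odd  v refl | odd  v′ refl = cong (λ u → suc (u * 2)) (trans (sym (β-odd v)) (trans eq (β-odd v′)))
  ... | even v refl | odd  v′ refl = ⊥-elim (high≢low (odd-half-< r′<n) (trans (sym (β-even v)) (trans eq (β-odd v′))))
  ... | odd  v refl | even v′ refl = ⊥-elim (high≢low (odd-half-< r<n) (trans (sym (β-even v′)) (trans (sym eq) (β-odd v))))

  permutation : Bool → ℕ → ℕ → ℕ
  permutation true  0             r = α r
  permutation true  1             r = β r
  permutation true  (suc (suc _)) r = r
  permutation false _             r = r

  permutation-< : ∀ e p {r} → r < n → permutation e p r < n
  permutation-< true  0             = α-<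
  permutation-< true  1             = β-<
  permutation-< true  (suc (suc _)) r<n = r<n
  permutation-< false _             r<n = r<n

  permutation-injective : ∀ e p {r r′} → r < n → r′ < n → permutation e p r ≡ permutation e p r′ → r ≡ r′
  permutation-injective true  0             = α-injective
  permutation-injective true  1             = β-injective
  permutation-injective true  (suc (suc _)) _ _ eq = eq
  permutation-injective false _             _ _ eq = eq


  headShift : Bool → ℕ
  headShift true  = n
  headShift false = 0

  headExcess : Bool → ℕ → ℕ
  headExcess true  B = suc (B + q)
  headExcess false _ = 0

  magnitudes : Bool → ℕ → ℕ → ℕ → ℕ
  magnitudes e B r p = suc (B + (p * n + permutation e p r))

  private
    next-row : ∀ B p r n → suc (B + (suc p * n + r)) ≡ suc (B + (p * n + r)) + n
    next-row = solve-∀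

    head-rows : ∀ B n x y q r → x + y ≡ q + r →
      suc (B + (0 * n + x)) + (suc (B + (1 * n + y)) + (0 + 0)) + n ≡ 0 + (0 + (suc (B + (2 * n + r)) + 0)) + suc (B + q)
    head-rows B n x y q r x+y≡q+r = trans (lhs B n x y) (trans (cong (λ z → 2 + B * 2 + n * 2 + z) x+y≡q+r) (rhs B n q r))
      where
      lhs : ∀ B n x y → suc (B + (0 * n + x)) + (suc (B + (1 * n + y)) + (0 + 0)) + n ≡ 2 + B * 2 + n * 2 + (x + y)
      lhs = solve-∀
      rhs : ∀ B n q r → 2 + B * 2 + n * 2 + (q + r) ≡ 0 + (0 + (suc (B + (2 * n + r)) + 0)) + suc (B + q)
      rhs = solve-∀

  -- When h is odd, rows 0, 1, 2 contribute α r + β r − r = q plus terms free of r; every later pair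
  -- of rows contributes n. Hence the signed sum does not depend on r.
  row-balance : ∀ e w B r →
    positive (headRows e + w * 2) (rowSign e) (magnitudes e B r) + headShift e
      ≡ negative (headRows e + w * 2) (rowSign e) (magnitudes e B r) + (headExcess e B + w * n)
  row-balance false w B r = trans (+-identityʳ _) (alternating-balance w n _ (λ v → next-row B (v * 2) r n))
  row-balance true  w B r = begin
    positive (3 + w * 2) (rowSign true) V + n ≡⟨ cong (_+ n) (∑-+ 3 (w * 2) (λ p → if rowSign true p then V p else 0)) ⟩
    (H⁺ + T⁺) + n          ≡⟨ cong (_+ n) (+-comm H⁺ T⁺) ⟩
    (T⁺ + H⁺) + n          ≡⟨ +-assoc T⁺ H⁺ n ⟩
    T⁺ + (H⁺ + n)          ≡⟨ cong₂ _+_ tail (head-rows B n (α r) (β r) q r (α+β r)) ⟩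
    (T⁻ + w * n) + (H⁻ + suc (B + q)) ≡⟨ interchange T⁻ (w * n) H⁻ _ ⟩
    (T⁻ + H⁻) + (w * n + suc (B + q)) ≡⟨ cong₂ _+_ (+-comm T⁻ H⁻) (+-comm (w * n) _) ⟩
    (H⁻ + T⁻) + (suc (B + q) + w * n) ≡⟨ cong (_+ (suc (B + q) + w * n)) (∑-+ 3 (w * 2) (λ p → if rowSign true p then 0 else V p)) ⟨
    negative (3 + w * 2) (rowSign true) V + (suc (B + q) + w * n) ∎
    where
    open ≡-Reasoning
    V : ℕ → ℕ
    V = magnitudes true B r
    H⁺ H⁻ T⁺ T⁻ : ℕ
    H⁺ = V 0 + (V 1 + (0 + 0))
    H⁻ = 0 + (0 + (V 2 + 0))
    T⁺ = positive (w * 2) alternating (λ i → V (3 + i))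
    T⁻ = negative (w * 2) alternating (λ i → V (3 + i))
    tail : T⁺ ≡ T⁻ + w * n
    tail = alternating-balance w n _ (λ v → next-row B (3 + v * 2) r n)

module OddColumns (q w c : ℕ) (e : Bool) .{{_ : NonZero (headRows e + w * 2)}} where

  open HalfShift q

  h : ℕ
  h = headRows e + w * 2

  open Digits n h

  private instance
    nh≢0 : NonZero (n * h)
    nh≢0 = m*n≢0 n h

  inner-< : ∀ {p r} → p < h → r < n → p * n + permutation e p r < n * h
  inner-< {p} {r} p<h r<n = subst (p * n + permutation e p r <_) (*-comm h n) (digit-bound p<h (permutation-< e p r<n))

  -- Position x = a n h + p n + r gets magnitude 1 + a n h + p n + π r, where π permutes at most rows 0 and 1.
  magnitude : ℕ → ℕ
  magnitude x = magnitudes e (high x * (n * h)) (low x) (mid x)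

  magnitude-range : ∀ {x} → x < n * h * c → 1 ≤ magnitude x × magnitude x ≤ n * h * c
  magnitude-range {x} x< = s≤s z≤n , subst (magnitude x ≤_) (*-comm c (n * h))
    (digit-bound (high< {c} x (subst (x <_) (*-comm (n * h) c) x<)) (inner-< (mid< x) (low< x)))

  magnitude-injective : ∀ {x y} → x < n * h * c → y < n * h * c → magnitude x ≡ magnitude y → x ≡ y
  magnitude-injective {x} {y} _ _ eq = digits-determine (proj₁ outer) (proj₁ inner)
    (permutation-injective e (mid x) (low< x) (low< y) (trans (proj₂ inner) (cong (λ p → permutation e p (low y)) (sym (proj₁ inner)))))
    where
    outer = digits-injective (n * h) (inner-< (mid< x) (low< x)) (inner-< (mid< y) (low< y)) (suc-injective eq)
    inner = digits-injective n (permutation-< e (mid x) (low< x)) (permutation-< e (mid y) (low< y)) (proj₂ outer)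

  labelling : Labelling (n * h * c)
  labelling = record
    { mag           = magnitude
    ; sign          = λ x → rowSign e (mid x)
    ; mag-range     = magnitude-range
    ; mag-injective = magnitude-injective
    }

  open SignedResidues (n * (h * 2) * c) (n * h * c) (paired-size n h c)
  open PairSequence (paired-size n h c) labelling

  column-magnitudes : ℕ → ℕ → ℕ → ℕ
  column-magnitudes a r = magnitudes e (a * (n * h)) r

  private
    signed-at : ∀ (f : Bool → Bool) x {a p r} → high x ≡ a → mid x ≡ p → low x ≡ r →
      signed (f (rowSign e (mid x))) (magnitude x) ≡ signed (f (rowSign e p)) (column-magnitudes a r p)
    signed-at f x refl refl refl = refl

  value-at-even : ∀ a {p r} → p < h → r < n →
    value ((a * (n * h) + (p * n + r)) * 2) ≡ signed (rowSign e p) (column-magnitudes a r p)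
  value-at-even a {p} {r} p<h r<n with digits₃-of a p<h r<n
  ... | a≡ , p≡ , r≡ = trans (value-even x) (signed-at (λ b → b) x a≡ p≡ r≡)
    where x = a * (n * h) + (p * n + r)

  value-at-odd : ∀ a {p r} → p < h → r < n →
    value (suc ((a * (n * h) + (p * n + r)) * 2)) ≡ signed (not (rowSign e p)) (column-magnitudes a r p)
  value-at-odd a {p} {r} p<h r<n with digits₃-of a p<h r<n
  ... | a≡ , p≡ , r≡ = trans (value-odd x) (signed-at not x a≡ p≡ r≡)
    where x = a * (n * h) + (p * n + r)

  column-magnitudes-≤ : ∀ {a p r} → a < c → p < h → r < n → column-magnitudes a r p ≤ P
  column-magnitudes-≤ {a} {p} {r} a<c p<h r<n = <⇒≤ (≤-<-trans
    (subst (column-magnitudes a r p ≤_) (*-comm c (n * h)) (digit-bound a<c (inner-< p<h r<n))) M<P)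

  private
    even-even : ∀ a n h p r → a * (n * (h * 2)) + (p * 2 * n + r * 2) ≡ (a * (n * h) + (p * n + r)) * 2
    even-even = solve-∀
    odd-even : ∀ a q h p r → a * (suc (q * 2) * (h * 2)) + (suc (p * 2) * suc (q * 2) + r * 2)
                            ≡ suc ((a * (suc (q * 2) * h) + (p * suc (q * 2) + (q + r))) * 2)
    odd-even = solve-∀
    even-odd : ∀ a n h p r → a * (n * (h * 2)) + (p * 2 * n + suc (r * 2)) ≡ suc ((a * (n * h) + (p * n + r)) * 2)
    even-odd = solve-∀
    odd-odd : ∀ a q h p r → a * (suc (q * 2) * (h * 2)) + (suc (p * 2) * suc (q * 2) + suc (r * 2))
                           ≡ (a * (suc (q * 2) * h) + (p * suc (q * 2) + suc (q + r))) * 2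
    odd-odd = solve-∀

  complementary-columns : ∀ {a r r′} → a < c → r < n → r′ < n →
    (∑[ p < h ] signed (rowSign e p) (column-magnitudes a r p) + ∑[ p < h ] signed (not (rowSign e p)) (column-magnitudes a r′ p)) % P ≡ 0
  complementary-columns {a} {r} {r′} a<c r<n r′<n = trans (cong (_% P)
    (∑-signed-complementary h (rowSign e) (column-magnitudes a r) (column-magnitudes a r′) (headShift e) (headExcess e (a * (n * h)) + w * n)
      (λ p p<h → column-magnitudes-≤ a<c p<h r<n) (λ p p<h → column-magnitudes-≤ a<c p<h r′<n)
      (row-balance e w (a * (n * h)) r) (row-balance e w (a * (n * h)) r′)))
    (m*n%n≡0 h P)

  -- Column 2r of array a carries column-magnitudes a r in its rows 2p and column-magnitudes a (q + r) in its
  -- rows 2p + 1, with opposite signs; column 2r + 1 likewise carries those of r and q + r + 1.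
  column-sum : ∀ {a j} → a < c → j < n → ∑[ l < h * 2 ] value (a * (n * (h * 2)) + (l * n + j)) % P ≡ 0
  column-sum {a} {j} a<c j<n with evenOrOdd j
  ... | even r refl = begin
    ∑[ l < h * 2 ] value (a * (n * (h * 2)) + (l * n + r * 2)) % P
      ≡⟨ cong (_% P) (trans (∑-pairs h (λ l → value (a * (n * (h * 2)) + (l * n + r * 2)))) (∑-cong h (λ p p<h → cong₂ _+_
           (trans (cong value (even-even a n h p r)) (value-at-even a p<h r<n))
           (trans (cong value (odd-even a q h p r)) (value-at-odd a p<h q+r<n))))) ⟩
    ∑[ p < h ] (signed (rowSign e p) (column-magnitudes a r p) + signed (not (rowSign e p)) (column-magnitudes a (q + r) p)) % P
      ≡⟨ cong (_% P) (∑-distrib-+ h _ _) ⟩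
    (∑[ p < h ] signed (rowSign e p) (column-magnitudes a r p) + ∑[ p < h ] signed (not (rowSign e p)) (column-magnitudes a (q + r) p)) % P
      ≡⟨ complementary-columns a<c r<n q+r<n ⟩
    0 ∎
    where
    open ≡-Reasoning
    r≤q : r ≤ q
    r≤q = even-half-≤ j<n
    r<n : r < n
    r<n = s≤s (≤-trans r≤q (m≤m*n q 2))
    q+r<n : q + r < n
    q+r<n = s≤s (subst (q + r ≤_) (n+n≡n*2 q) (+-monoʳ-≤ q r≤q))
  ... | odd r refl = begin
    ∑[ l < h * 2 ] value (a * (n * (h * 2)) + (l * n + suc (r * 2))) % P
      ≡⟨ cong (_% P) (trans (∑-pairs h (λ l → value (a * (n * (h * 2)) + (l * n + suc (r * 2))))) (∑-cong h (λ p p<h → cong₂ _+_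
           (trans (cong value (even-odd a n h p r)) (value-at-odd a p<h r<n))
           (trans (cong value (odd-odd a q h p r)) (value-at-even a p<h 1+q+r<n))))) ⟩
    ∑[ p < h ] (signed (not (rowSign e p)) (column-magnitudes a r p) + signed (rowSign e p) (column-magnitudes a (suc (q + r)) p)) % P
      ≡⟨ cong (_% P) (trans (∑-distrib-+ h _ _) (+-comm (∑[ p < h ] signed (not (rowSign e p)) (column-magnitudes a r p)) _)) ⟩
    (∑[ p < h ] signed (rowSign e p) (column-magnitudes a (suc (q + r)) p) + ∑[ p < h ] signed (not (rowSign e p)) (column-magnitudes a r p)) % P
      ≡⟨ complementary-columns a<c 1+q+r<n r<n ⟩
    0 ∎
    where
    open ≡-Reasoning
    r<q : r < q
    r<q = odd-half-< j<n
    r<n : r < n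
    r<n = s≤s (≤-trans (<⇒≤ r<q) (m≤m*n q 2))
    1+q+r<n : suc (q + r) < n
    1+q+r<n = s≤s (subst (q + r <_) (n+n≡n*2 q) (+-monoʳ-< q r<q))

  odd-width-M0S : ∀ {m s₂} .{{_ : NonZero m}} .{{_ : NonZero s₂}} → s₂ * 2 ≤ n → m * (s₂ * 2) ≡ n * (h * 2) →
    M0S-exists m n (s₂ * 2) (h * 2) c
  odd-width-M0S s≤n ms≡nk = PairedArrays.paired-M0S {h = h} {c = c} s≤n ms≡nk labelling column-sum

-- An even number of columns

-- Groups 2v and 2v + 1 of six signed values share 12v + 1, …, 12v + 12: the first takes
-- +1 −2 −3 +5 +6 −7 and the second +4 −8 −9 −10 +11 +12, both summing to zero.
pairTable : ℕ → ℕ → ℕ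
pairTable 0       0 = 1
pairTable 0       1 = 2
pairTable 0       2 = 3
pairTable 0       3 = 5
pairTable 0       4 = 6
pairTable 0       _ = 7
pairTable (suc _) 0 = 4
pairTable (suc _) 1 = 8
pairTable (suc _) 2 = 9
pairTable (suc _) 3 = 10
pairTable (suc _) 4 = 11
pairTable (suc _) _ = 12

pairSign : ℕ → ℕ → Bool
pairSign 0       0 = true
pairSign 0       1 = false
pairSign 0       2 = false
pairSign 0       3 = true
pairSign 0       4 = true
pairSign 0       _ = false
pairSign (suc _) 0 = true
pairSign (suc _) 1 = false
pairSign (suc _) 2 = false
pairSign (suc _) 3 = false
pairSign (suc _) 4 = true
pairSign (suc _) _ = true

pairTable⁻¹ : ℕ → ℕ × ℕ
pairTable⁻¹ 1  = 0 , 0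
pairTable⁻¹ 2  = 0 , 1
pairTable⁻¹ 3  = 0 , 2
pairTable⁻¹ 4  = 1 , 0
pairTable⁻¹ 5  = 0 , 3
pairTable⁻¹ 6  = 0 , 4
pairTable⁻¹ 7  = 0 , 5
pairTable⁻¹ 8  = 1 , 1
pairTable⁻¹ 9  = 1 , 2
pairTable⁻¹ 10 = 1 , 3
pairTable⁻¹ 11 = 1 , 4
pairTable⁻¹ _  = 1 , 5

pairTable⁻¹-pairTable : ∀ {b o} → b < 2 → o < 6 → pairTable⁻¹ (pairTable b o) ≡ (b , o)
pairTable⁻¹-pairTable {0} {0} _ _ = refl
pairTable⁻¹-pairTable {0} {1} _ _ = refl
pairTable⁻¹-pairTable {0} {2} _ _ = refl
pairTable⁻¹-pairTable {0} {3} _ _ = refl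
pairTable⁻¹-pairTable {0} {4} _ _ = refl
pairTable⁻¹-pairTable {0} {5} _ _ = refl
pairTable⁻¹-pairTable {1} {0} _ _ = refl
pairTable⁻¹-pairTable {1} {1} _ _ = refl
pairTable⁻¹-pairTable {1} {2} _ _ = refl
pairTable⁻¹-pairTable {1} {3} _ _ = refl
pairTable⁻¹-pairTable {1} {4} _ _ = refl
pairTable⁻¹-pairTable {1} {5} _ _ = refl
pairTable⁻¹-pairTable {suc (suc _)} (s≤s (s≤s ())) _
pairTable⁻¹-pairTable {_} {suc (suc (suc (suc (suc (suc _)))))} _ (s≤s (s≤s (s≤s (s≤s (s≤s (s≤s ()))))))

pairTable-range : ∀ b o → 1 ≤ pairTable b o × pairTable b o ≤ 12
pairTable-range 0       0 = s≤s z≤n , s≤s z≤n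
pairTable-range 0       1 = s≤s z≤n , s≤s (s≤s z≤n)
pairTable-range 0       2 = s≤s z≤n , s≤s (s≤s (s≤s z≤n))
pairTable-range 0       3 = s≤s z≤n , s≤s (s≤s (s≤s (s≤s (s≤s z≤n))))
pairTable-range 0       4 = s≤s z≤n , s≤s (s≤s (s≤s (s≤s (s≤s (s≤s z≤n)))))
pairTable-range 0       (suc (suc (suc (suc (suc _))))) = s≤s z≤n , s≤s (s≤s (s≤s (s≤s (s≤s (s≤s (s≤s z≤n))))))
pairTable-range (suc _) 0 = s≤s z≤n , s≤s (s≤s (s≤s (s≤s z≤n)))
pairTable-range (suc _) 1 = s≤s z≤n , s≤s (s≤s (s≤s (s≤s (s≤s (s≤s (s≤s (s≤s z≤n)))))))
pairTable-range (suc _) 2 = s≤s z≤n , s≤s (s≤s (s≤s (s≤s (s≤s (s≤s (s≤s (s≤s (s≤s z≤n))))))))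
pairTable-range (suc _) 3 = s≤s z≤n , s≤s (s≤s (s≤s (s≤s (s≤s (s≤s (s≤s (s≤s (s≤s (s≤s z≤n)))))))))
pairTable-range (suc _) 4 = s≤s z≤n , s≤s (s≤s (s≤s (s≤s (s≤s (s≤s (s≤s (s≤s (s≤s (s≤s (s≤s z≤n))))))))))
pairTable-range (suc _) (suc (suc (suc (suc (suc _))))) = s≤s z≤n , ≤-refl

singleSign : ℕ → Bool
singleSign 0 = false
singleSign 1 = true
singleSign 2 = false
singleSign _ = true

-- The six-term sums below are stated in the form they compute to, which the ring solver can compare.
pair-balance : ∀ b B → b < 2 →
  positive 6 (pairSign b) (λ o → B + pairTable b o) ≡ negative 6 (pairSign b) (λ o → B + pairTable b o)
pair-balance 0 B _ = first B
  where
  first : ∀ B → (B + 1) + (0 + (0 + ((B + 5) + ((B + 6) + (0 + 0)))))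
              ≡ 0 + ((B + 2) + ((B + 3) + (0 + (0 + ((B + 7) + 0)))))
  first = solve-∀
pair-balance 1 B _ = second B
  where
  second : ∀ B → (B + 4) + (0 + (0 + (0 + ((B + 11) + ((B + 12) + 0)))))
               ≡ 0 + ((B + 8) + ((B + 9) + ((B + 10) + (0 + (0 + 0)))))
  second = solve-∀
pair-balance (suc (suc _)) _ (s≤s (s≤s ()))

-- The unpaired group takes 12t + 1, …, 12t + 6 as −1 +2 −3 +4 +5 +6; after shifting every value by R its
-- signed sum is 2 (R + 12t) + 13, which is the modulus once there are 2t + 1 groups.
single-balance : ∀ B → positive 6 singleSign (λ o → B + suc o) ≡ negative 6 singleSign (λ o → B + suc o) + 1 * suc ((B + 6) * 2)
single-balance = signed-sum
  where
  signed-sum : ∀ B → 0 + ((B + 2) + (0 + ((B + 4) + ((B + 5) + ((B + 6) + 0)))))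
                   ≡ ((B + 1) + (0 + ((B + 3) + (0 + (0 + (0 + 0)))))) + 1 * suc ((B + 6) * 2)
  signed-sum = solve-∀

twelve-digits : ∀ {v v′ x x′} → 1 ≤ x → x ≤ 12 → 1 ≤ x′ → x′ ≤ 12 → 12 * v + x ≡ 12 * v′ + x′ → v ≡ v′ × x ≡ x′
twelve-digits {v} {v′} {suc x} {suc x′} _ x<12 _ x′<12 eq =
  Product.map₂ (cong suc) (digits-injective 12 x<12 x′<12 (suc-injective (trans (sym (shift v x)) (trans eq (shift v′ x′)))))
  where
  shift : ∀ v x → 12 * v + suc x ≡ suc (v * 12 + x)
  shift = solve-∀

module SixBlocks (G t : ℕ) (G≤1+2t : G ≤ suc (t * 2)) (2t≤G : t * 2 ≤ G) where

  special : ℕ → ℕ → ℕ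
  special g o with g <? t * 2
  ... | yes _ = 12 * (g / 2) + pairTable (g % 2) o
  ... | no  _ = 12 * t + suc o

  specialSign : ℕ → ℕ → Bool
  specialSign g o with g <? t * 2
  ... | yes _ = pairSign (g % 2) o
  ... | no  _ = singleSign o

  unpaired : ∀ {g} → g < G → ¬ g < t * 2 → g ≡ t * 2 × G ≡ suc (t * 2)
  unpaired g<G g≮2t = g≡2t , ≤-antisym G≤1+2t (subst (_< G) g≡2t g<G)
    where
    g≡2t = ≤-antisym (≤-pred (≤-trans g<G G≤1+2t)) (≮⇒≥ g≮2t)

  paired-≤ : ∀ {g} o → g < t * 2 → 12 * (g / 2) + pairTable (g % 2) o ≤ 12 * t
  paired-≤ {g} o g<2t = begin
    12 * (g / 2) + pairTable (g % 2) o ≤⟨ +-monoʳ-≤ (12 * (g / 2)) (proj₂ (pairTable-range (g % 2) o)) ⟩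
    12 * (g / 2) + 12                  ≡⟨ +-comm (12 * (g / 2)) 12 ⟩
    12 + 12 * (g / 2)                  ≡⟨ *-suc 12 (g / 2) ⟨
    12 * suc (g / 2)                   ≤⟨ *-monoʳ-≤ 12 (m<n*o⇒m/o<n {g} {t} {2} g<2t) ⟩
    12 * t                             ∎
    where open ≤-Reasoning

  special-range : ∀ {g o} → g < G → o < 6 → 1 ≤ special g o × special g o ≤ 6 * G
  special-range {g} {o} g<G o<6 with g <? t * 2
  ... | yes g<2t = ≤-trans (proj₁ (pairTable-range (g % 2) o)) (m≤n+m _ _) ,
                   ≤-trans (paired-≤ o g<2t) (subst (_≤ 6 * G) (twelve-t t) (*-monoʳ-≤ 6 2t≤G))
    where
    twelve-t : ∀ t → 6 * (t * 2) ≡ 12 * t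
    twelve-t = solve-∀
  ... | no  g≮2t = ≤-trans (s≤s z≤n) (m≤n+m (suc o) (12 * t)) , subst (12 * t + suc o ≤_) (trans (six-groups t) (cong (6 *_) (sym (proj₂ (unpaired g<G g≮2t)))))
                     (+-monoʳ-≤ (12 * t) o<6)
    where
    six-groups : ∀ t → 12 * t + 6 ≡ 6 * suc (t * 2)
    six-groups = solve-∀

  special-injective : ∀ {g g′ o o′} → g < G → g′ < G → o < 6 → o′ < 6 → special g o ≡ special g′ o′ → g ≡ g′ × o ≡ o′
  special-injective {g} {g′} {o} {o′} g<G g′<G o<6 o′<6 eq with g <? t * 2 | g′ <? t * 2
  ... | yes _ | yes _ = g≡g′ , cong proj₂ parts
    where
    halves = twelve-digits {g / 2} {g′ / 2} (proj₁ (pairTable-range (g % 2) o)) (proj₂ (pairTable-range (g % 2) o))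
                           (proj₁ (pairTable-range (g′ % 2) o′)) (proj₂ (pairTable-range (g′ % 2) o′)) eq
    parts : (g % 2 , o) ≡ (g′ % 2 , o′)
    parts = trans (sym (pairTable⁻¹-pairTable (m%n<n g 2) o<6))
              (trans (cong pairTable⁻¹ (proj₂ halves)) (pairTable⁻¹-pairTable (m%n<n g′ 2) o′<6))
    g≡g′ : g ≡ g′
    g≡g′ = trans (m≡m%n+[m/n]*n g 2) (trans (cong₂ (λ r q → r + q * 2) (cong proj₁ parts) (proj₁ halves)) (sym (m≡m%n+[m/n]*n g′ 2)))
  ... | no g≮2t | no g′≮2t = trans (proj₁ (unpaired g<G g≮2t)) (sym (proj₁ (unpaired g′<G g′≮2t))) ,
                             suc-injective (+-cancelˡ-≡ (12 * t) _ _ eq)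
  ... | yes g<2t | no _ = contradiction eq (<⇒≢ (≤-<-trans (paired-≤ o g<2t) (m<m+n (12 * t) (s≤s z≤n))))
  ... | no _ | yes g′<2t = contradiction (sym eq) (<⇒≢ (≤-<-trans (paired-≤ o′ g′<2t) (m<m+n (12 * t) (s≤s z≤n))))

  special-balance : ∀ {g} R → g < G → Σ ℕ λ z →
    positive 6 (specialSign g) (λ o → R + special g o) ≡ negative 6 (specialSign g) (λ o → R + special g o) + z * suc ((R + 6 * G) * 2)
  special-balance {g} R g<G with g <? t * 2
  ... | yes _ = 0 , (begin
    positive 6 (pairSign (g % 2)) (λ o → R + (12 * (g / 2) + pairTable (g % 2) o))
      ≡⟨ positive-cong 6 {b = pairSign (g % 2)} (λ _ _ → refl) (λ o _ → sym (+-assoc R (12 * (g / 2)) (pairTable (g % 2) o))) ⟩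
    positive 6 (pairSign (g % 2)) (λ o → R + 12 * (g / 2) + pairTable (g % 2) o)
      ≡⟨ pair-balance (g % 2) (R + 12 * (g / 2)) (m%n<n g 2) ⟩
    negative 6 (pairSign (g % 2)) (λ o → R + 12 * (g / 2) + pairTable (g % 2) o)
      ≡⟨ negative-cong 6 {b = pairSign (g % 2)} (λ _ _ → refl) (λ o _ → +-assoc R (12 * (g / 2)) (pairTable (g % 2) o)) ⟩
    negative 6 (pairSign (g % 2)) (λ o → R + (12 * (g / 2) + pairTable (g % 2) o))
      ≡⟨ +-identityʳ _ ⟨
    negative 6 (pairSign (g % 2)) (λ o → R + (12 * (g / 2) + pairTable (g % 2) o)) + 0 ∎)
    where open ≡-Reasoning
  ... | no g≮2t = 1 , (begin
    positive 6 singleSign (λ o → R + (12 * t + suc o))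
      ≡⟨ positive-cong 6 {b = singleSign} (λ _ _ → refl) (λ o _ → sym (+-assoc R (12 * t) (suc o))) ⟩
    positive 6 singleSign (λ o → R + 12 * t + suc o)
      ≡⟨ single-balance (R + 12 * t) ⟩
    negative 6 singleSign (λ o → R + 12 * t + suc o) + 1 * suc ((R + 12 * t + 6) * 2)
      ≡⟨ cong₂ _+_ (negative-cong 6 {b = singleSign} (λ _ _ → refl) (λ o _ → +-assoc R (12 * t) (suc o))) (cong (λ M → 1 * suc (M * 2)) modulus) ⟩
    negative 6 singleSign (λ o → R + (12 * t + suc o)) + 1 * suc ((R + 6 * G) * 2) ∎)
    where
    open ≡-Reasoning
    modulus : R + 12 * t + 6 ≡ R + 6 * G
    modulus = trans (regroup R t) (cong (λ G → R + 6 * G) (sym (proj₂ (unpaired g<G g≮2t))))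
      where
      regroup : ∀ R t → R + 12 * t + 6 ≡ R + 6 * suc (t * 2)
      regroup = solve-∀

quadSign : ℕ → Bool
quadSign 0                         = true
quadSign 1                         = false
quadSign 2                         = false
quadSign 3                         = true
quadSign (suc (suc (suc (suc l)))) = quadSign l

-- x − (x + 1) − (x + 2) + (x + 3) = 0
quad-balance : ∀ w X → positive (w * 4) quadSign (λ l → suc (X + l)) ≡ negative (w * 4) quadSign (λ l → suc (X + l))
quad-balance zero    X = refl
quad-balance (suc w) X = first-four X _ _ (begin
  positive (w * 4) quadSign (λ l → suc (X + (4 + l)))   ≡⟨ positive-cong (w * 4) (λ _ _ → refl) (λ l _ → cong suc (sym (+-assoc X 4 l))) ⟩
  positive (w * 4) quadSign (λ l → suc (X + 4 + l))     ≡⟨ quad-balance w (X + 4) ⟩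
  negative (w * 4) quadSign (λ l → suc (X + 4 + l))     ≡⟨ negative-cong (w * 4) (λ _ _ → refl) (λ l _ → cong suc (+-assoc X 4 l)) ⟩
  negative (w * 4) quadSign (λ l → suc (X + (4 + l)))   ∎)
  where
  open ≡-Reasoning
  first-four : ∀ X A B → A ≡ B → suc (X + 0) + (0 + (0 + (suc (X + 3) + A))) ≡ 0 + (suc (X + 1) + (suc (X + 2) + (0 + B)))
  first-four X A B refl = normal-form X A
    where
    normal-form : ∀ X A → suc (X + 0) + (0 + (0 + (suc (X + 3) + A))) ≡ 0 + (suc (X + 1) + (suc (X + 2) + (0 + A)))
    normal-form = solve-∀

module EvenColumns (d w c : ℕ) (e : Bool) .{{_ : NonZero d}} .{{_ : NonZero (headRows e + w * 2)}} where

  n h k G w4 R : ℕ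
  n  = d * 2
  h  = headRows e + w * 2
  k  = h * 2
  G  = c * d
  w4 = w * 4
  R  = G * w4

  private instance
    k≢0 : NonZero k
    k≢0 = m*n≢0 h 2
    n≢0 : NonZero n
    n≢0 = m*n≢0 d 2

  k≡ : k ≡ w4 + headRows e * 2
  k≡ = regroup (headRows e) w
    where
    regroup : ∀ x w → (x + w * 2) * 2 ≡ w * 4 + x * 2
    regroup = solve-∀

  M≡ : n * h * c ≡ R + headRows e * 2 * G
  M≡ = regroup d (headRows e) w c
    where
    regroup : ∀ d x w c → d * 2 * (x + w * 2) * c ≡ c * d * (w * 4) + x * 2 * (c * d)
    regroup = solve-∀

  G≤1+2t : G ≤ suc (G / 2 * 2)
  G≤1+2t = subst (_≤ suc (G / 2 * 2)) (sym (m≡m%n+[m/n]*n G 2)) (+-monoˡ-≤ (G / 2 * 2) (≤-pred (m%n<n G 2)))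

  open SixBlocks G (G / 2) G≤1+2t (m/n*n≤m G 2)

  magnitude : ℕ → ℕ → ℕ
  magnitude g l with l <? w4
  ... | yes _ = suc (g * w4 + l)
  ... | no  _ = R + special g (l ∸ w4)

  sign : ℕ → ℕ → Bool
  sign g l with l <? w4
  ... | yes _ = quadSign l
  ... | no  _ = specialSign g (l ∸ w4)

  at-quad : ∀ g {l} → l < w4 → sign g l ≡ quadSign l × magnitude g l ≡ suc (g * w4 + l)
  at-quad g {l} l<w4 with l <? w4
  ... | yes _    = refl , refl
  ... | no  l≮w4 = contradiction l<w4 l≮w4

  at-special : ∀ g o → sign g (w4 + o) ≡ specialSign g o × magnitude g (w4 + o) ≡ R + special g o
  at-special g o with w4 + o <? w4
  ... | yes w4+o<w4 = contradiction w4+o<w4 (m+n≮m w4 o)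
  ... | no  _       = cong (specialSign g) (m+n∸m≡n w4 o) , cong (λ o → R + special g o) (m+n∸m≡n w4 o)

  special-index : ∀ {l} → l < k → ¬ l < w4 → e ≡ true × l ∸ w4 < 6
  special-index {l} l<k l≮w4 = index e (subst (l <_) k≡ l<k)
    where
    index : ∀ b → l < w4 + headRows b * 2 → b ≡ true × l ∸ w4 < 6
    index true  l<w4+6 = refl , +-cancelˡ-< w4 _ _ (subst (_< w4 + 6) (sym (m+[n∸m]≡n (≮⇒≥ l≮w4))) l<w4+6)
    index false l<w4+0 = contradiction (subst (l <_) (+-identityʳ w4) l<w4+0) l≮w4

  magnitude-range : ∀ {g l} → g < G → l < k → 1 ≤ magnitude g l × magnitude g l ≤ n * h * c
  magnitude-range {g} {l} g<G l<k with l <? w4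
  ... | yes l<w4 = s≤s z≤n , ≤-trans (digit-bound g<G l<w4) (subst (R ≤_) (sym M≡) (m≤m+n R _))
  ... | no  l≮w4 with special-index l<k l≮w4
  ...   | refl , o<6 = ≤-trans (proj₁ (special-range g<G o<6)) (m≤n+m _ R) ,
                       subst (R + special g (l ∸ w4) ≤_) (sym M≡) (+-monoʳ-≤ R (proj₂ (special-range g<G o<6)))

  quad-below-special : ∀ {g g′ l l′} → g < G → g′ < G → l < w4 → l′ < k → ¬ l′ < w4 →
    suc (g * w4 + l) < R + special g′ (l′ ∸ w4)
  quad-below-special g<G g′<G l<w4 l′<k l′≮w4 =
    ≤-<-trans (digit-bound g<G l<w4) (m<m+n R (proj₁ (special-range g′<G (proj₂ (special-index l′<k l′≮w4)))))

  magnitude-injective : ∀ {g g′ l l′} → g < G → g′ < G → l < k → l′ < k →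
    magnitude g l ≡ magnitude g′ l′ → g ≡ g′ × l ≡ l′
  magnitude-injective {g} {g′} {l} {l′} g<G g′<G l<k l′<k eq with l <? w4 | l′ <? w4
  ... | yes l<w4 | yes l′<w4 = digits-injective w4 {{>-nonZero (≤-<-trans z≤n l<w4)}} l<w4 l′<w4 (suc-injective eq)
  ... | no l≮w4 | no l′≮w4 = proj₁ same , (begin
      l                 ≡⟨ m+[n∸m]≡n (≮⇒≥ l≮w4) ⟨
      w4 + (l ∸ w4)     ≡⟨ cong (w4 +_) (proj₂ same) ⟩
      w4 + (l′ ∸ w4)    ≡⟨ m+[n∸m]≡n (≮⇒≥ l′≮w4) ⟩
      l′                ∎)
    where
    open ≡-Reasoning
    same = special-injective g<G g′<G (proj₂ (special-index l<k l≮w4)) (proj₂ (special-index l′<k l′≮w4)) (+-cancelˡ-≡ R _ _ eq)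
  ... | yes l<w4 | no l′≮w4 = contradiction eq (<⇒≢ (quad-below-special g<G g′<G l<w4 l′<k l′≮w4))
  ... | no l≮w4 | yes l′<w4 = contradiction (sym eq) (<⇒≢ (quad-below-special g′<G g<G l′<w4 l<k l≮w4))

  open Digits d k

  -- Position x = a d k + l d + r of the half-sequence is entry l of group a d + r.
  group : ℕ → ℕ
  group x = high x * d + low x

  group-< : ∀ {x} → x < n * h * c → group x < G
  group-< {x} x< = digit-bound (high< {c} x (subst (x <_) (regroup d (headRows e) w c) x<)) (low< x)
    where
    regroup : ∀ d x w c → d * 2 * (x + w * 2) * c ≡ c * (d * ((x + w * 2) * 2))
    regroup = solve-∀

  labelling : Labelling (n * h * c)
  labelling = record
    { mag           = λ x → magnitude (group x) (mid x)
    ; sign          = λ x → sign (group x) (mid x)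
    ; mag-range     = λ x< → magnitude-range (group-< x<) (mid< _)
    ; mag-injective = injective
    }
    where
    injective : ∀ {x y} → x < n * h * c → y < n * h * c → magnitude (group x) (mid x) ≡ magnitude (group y) (mid y) → x ≡ y
    injective {x} {y} x< y< eq = digits-determine (proj₁ same-group) (proj₂ same) (proj₂ same-group)
      where
      same = magnitude-injective (group-< x<) (group-< y<) (mid< x) (mid< y) eq
      same-group = digits-injective d (low< x) (low< y) (proj₁ same)

  open SignedResidues (n * (h * 2) * c) (n * h * c) (paired-size n h c)
  open PairSequence (paired-size n h c) labelling

  special-part : ∀ {g} b → n * h * c ≡ R + headRows b * 2 * G → g < G → Σ ℕ λ z →
    positive (headRows b * 2) (specialSign g) (λ o → R + special g o) ≡ negative (headRows b * 2) (specialSign g) (λ o → R + special g o) + z * P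
  special-part false _   _   = 0 , refl
  special-part {g} true  M≡R+6G g<G with special-balance R g<G
  ... | z , balanced = z , trans balanced (cong (λ M → negative 6 (specialSign g) (λ o → R + special g o) + z * suc M)
                                                  (sym (trans (paired-size n h c) (cong (_* 2) M≡R+6G))))

  group-balance : ∀ {g} → g < G → Σ ℕ λ z → positive k (sign g) (magnitude g) ≡ negative k (sign g) (magnitude g) + z * P
  group-balance {g} g<G with special-part e M≡ g<G
  ... | z , special-balanced = z , (begin
    positive k (sign g) (magnitude g)
      ≡⟨ cong (λ L → positive L (sign g) (magnitude g)) k≡ ⟩
    positive (w4 + S) (sign g) (magnitude g)
      ≡⟨ positive-+ w4 S (sign g) (magnitude g) ⟩
    positive w4 (sign g) (magnitude g) + positive S (λ o → sign g (w4 + o)) (λ o → magnitude g (w4 + o))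
      ≡⟨ cong₂ _+_ (positive-cong w4 (λ l l< → proj₁ (at-quad g l<)) (λ l l< → proj₂ (at-quad g l<)))
                   (positive-cong S (λ o _ → proj₁ (at-special g o)) (λ o _ → proj₂ (at-special g o))) ⟩
    positive w4 quadSign (λ l → suc (g * w4 + l)) + positive S (specialSign g) (λ o → R + special g o)
      ≡⟨ cong₂ _+_ (quad-balance w (g * w4)) special-balanced ⟩
    negative w4 quadSign (λ l → suc (g * w4 + l)) + (negative S (specialSign g) (λ o → R + special g o) + z * P)
      ≡⟨ +-assoc (negative w4 quadSign (λ l → suc (g * w4 + l))) (negative S (specialSign g) (λ o → R + special g o)) (z * P) ⟨
    negative w4 quadSign (λ l → suc (g * w4 + l)) + negative S (specialSign g) (λ o → R + special g o) + z * P
      ≡⟨ cong (_+ z * P) (cong₂ _+_ (negative-cong w4 (λ l l< → sym (proj₁ (at-quad g l<))) (λ l l< → sym (proj₂ (at-quad g l<))))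
                                    (negative-cong S (λ o _ → sym (proj₁ (at-special g o))) (λ o _ → sym (proj₂ (at-special g o))))) ⟩
    negative w4 (sign g) (magnitude g) + negative S (λ o → sign g (w4 + o)) (λ o → magnitude g (w4 + o)) + z * P
      ≡⟨ cong (_+ z * P) (negative-+ w4 S (sign g) (magnitude g)) ⟨
    negative (w4 + S) (sign g) (magnitude g) + z * P
      ≡⟨ cong (λ L → negative L (sign g) (magnitude g) + z * P) k≡ ⟨
    negative k (sign g) (magnitude g) + z * P ∎)
    where
    open ≡-Reasoning
    S : ℕ
    S = headRows e * 2

  private
    signed-at : ∀ (f : Bool → Bool) x {a l r} → high x ≡ a → mid x ≡ l → low x ≡ r →
      signed (f (sign (group x) (mid x))) (magnitude (group x) (mid x)) ≡ signed (f (sign (a * d + r) l)) (magnitude (a * d + r) l)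
    signed-at f x refl refl refl = refl

    even-position : ∀ a d k l r → a * (d * 2 * k) + (l * (d * 2) + r * 2) ≡ (a * (d * k) + (l * d + r)) * 2
    even-position = solve-∀
    odd-position : ∀ a d k l r → a * (d * 2 * k) + (l * (d * 2) + suc (r * 2)) ≡ suc ((a * (d * k) + (l * d + r)) * 2)
    odd-position = solve-∀

  magnitude-≤ : ∀ {g l} → g < G → l < k → magnitude g l ≤ P
  magnitude-≤ g<G l<k = <⇒≤ (≤-<-trans (proj₂ (magnitude-range g<G l<k)) M<P)

  value-at-even : ∀ a {l r} → l < k → r < d → value ((a * (d * k) + (l * d + r)) * 2) ≡ signed (sign (a * d + r) l) (magnitude (a * d + r) l)
  value-at-even a {l} {r} l<k r<d with digits₃-of a l<k r<d
  ... | a≡ , l≡ , r≡ = trans (value-even x) (signed-at (λ b → b) x a≡ l≡ r≡)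
    where x = a * (d * k) + (l * d + r)

  value-at-odd : ∀ a {l r} → l < k → r < d → value (suc ((a * (d * k) + (l * d + r)) * 2)) ≡ signed (not (sign (a * d + r) l)) (magnitude (a * d + r) l)
  value-at-odd a {l} {r} l<k r<d with digits₃-of a l<k r<d
  ... | a≡ , l≡ , r≡ = trans (value-odd x) (signed-at not x a≡ l≡ r≡)
    where x = a * (d * k) + (l * d + r)

  -- Column 2r of array a holds group a d + r, and column 2r + 1 the same group with the opposite signs.
  column-sum : ∀ {a j} → a < c → j < n → ∑[ l < k ] value (a * (n * k) + (l * n + j)) % P ≡ 0
  column-sum {a} {j} a<c j<n with evenOrOdd j
  ... | even r refl = trans (cong (_% P) (∑-cong k (λ l l<k → trans (cong value (even-position a d k l r)) (value-at-even a l<k r<d))))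
                            (proj₁ (∑-signed-≡0 k (sign g) (magnitude g) z (λ l l<k → magnitude-≤ g<G l<k) balanced))
    where
    r<d : r < d
    r<d = *-cancelʳ-< 2 r d j<n
    g = a * d + r
    g<G = digit-bound a<c r<d
    z = proj₁ (group-balance g<G)
    balanced = proj₂ (group-balance g<G)
  ... | odd r refl = trans (cong (_% P) (∑-cong k (λ l l<k → trans (cong value (odd-position a d k l r)) (value-at-odd a l<k r<d))))
                           (proj₂ (∑-signed-≡0 k (sign g) (magnitude g) z (λ l l<k → magnitude-≤ g<G l<k) balanced))
    where
    r<d : r < d
    r<d = *-cancelʳ-< 2 r d (<-trans (n<1+n (r * 2)) j<n)
    g = a * d + r
    g<G = digit-bound a<c r<d
    z = proj₁ (group-balance g<G)
    balanced = proj₂ (group-balance g<G)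

  even-width-M0S : ∀ {m s₂} .{{_ : NonZero m}} .{{_ : NonZero s₂}} → s₂ * 2 ≤ n → m * (s₂ * 2) ≡ n * k →
    M0S-exists m n (s₂ * 2) k c
  even-width-M0S s≤n ms≡nk = PairedArrays.paired-M0S {h = h} {c = c} s≤n ms≡nk labelling column-sum

-- Transposition

M0S-transpose : ∀ {m n s k c} → m * s ≡ n * k → M0S-exists n m k s c → M0S-exists m n s k c
M0S-transpose {m} {n} {s} {k} {c} ms≡nk (B , ≢0 , cover , distinct , rows , columns , row-sums , column-sums) =
  subst (λ N → Σ (Fin c → PArray (suc N) m n) (IsM0S N m n s k c)) (cong (_* c) ms≡nk)
    ( (λ a i j → B a j i)
    , (λ a i j → ≢0 a j i)
    , (λ x x≢0 → let (a , j , i , eq) = cover x x≢0 in a , i , j , eq)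
    , (λ a i j a′ i′ j′ x eq eq′ → let (a≡ , j≡ , i≡) = distinct a j i a′ j′ i′ x eq eq′ in a≡ , i≡ , j≡)
    , columns , rows , column-sums , row-sums )

headRows-split : ∀ {h} → 2 ≤ h → Σ Bool λ e → Σ ℕ λ w → headRows e + w * 2 ≡ h
headRows-split {h} 2≤h with evenOrOdd h
... | even w refl = false , w , refl
... | odd zero refl = contradiction 2≤h (λ { (s≤s ()) })
... | odd (suc w) refl = true , w , refl

even-sides-M0S : ∀ {m n s₂ h c} .{{_ : NonZero m}} .{{_ : NonZero n}} .{{_ : NonZero s₂}} →
  2 ≤ h → s₂ * 2 ≤ n → m * (s₂ * 2) ≡ n * (h * 2) → M0S-exists m n (s₂ * 2) (h * 2) c
even-sides-M0S {n = n} {c = c} 2≤h s≤n ms≡nk with evenOrOdd n | headRows-split 2≤h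
... | even d refl | e , w , refl =
  EvenColumns.even-width-M0S d w c e {{m*n≢0⇒m≢0 d}} {{>-nonZero (≤-trans (s≤s z≤n) 2≤h)}} s≤n ms≡nk
... | odd  q refl | e , w , refl =
  OddColumns.odd-width-M0S q w c e {{>-nonZero (≤-trans (s≤s z≤n) 2≤h)}} s≤n ms≡nk

half-positive : ∀ {x} → 2 ≤ x * 2 → 0 < x
half-positive {x} 2≤x*2 = *-cancelʳ-< 2 0 x (≤-trans (s≤s z≤n) 2≤x*2)

lemma5p1 : (m n s k c : ℕ) → 1 ≤ m → 1 ≤ n → 1 ≤ s → 1 ≤ k → 1 ≤ c →
    2 ≤ s → s ≤ n → 2 ≤ k → k ≤ m → m * s ≡ n * k →
    2 ∣ s → 2 ∣ k → ¬ (s ≡ 2 × k ≡ 2) →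
    M0S-exists m n s k c
lemma5p1 m n s k c 1≤m 1≤n _ _ _ 2≤s s≤n 2≤k k≤m ms≡nk (divides s₂ refl) (divides h refl) not-both-2 with 2 ≤? h
... | yes 2≤h = even-sides-M0S {s₂ = s₂} {{>-nonZero 1≤m}} {{>-nonZero 1≤n}} {{>-nonZero (half-positive 2≤s)}} 2≤h s≤n ms≡nk
... | no  h≱2 = M0S-transpose ms≡nk
  (even-sides-M0S {s₂ = h} {{>-nonZero 1≤n}} {{>-nonZero 1≤m}} {{>-nonZero (half-positive 2≤k)}} 2≤s₂ k≤m (sym ms≡nk))
  where
  h≡1 : h ≡ 1
  h≡1 = ≤-antisym (≤-pred (≰⇒> h≱2)) (half-positive 2≤k)
  2≤s₂ : 2 ≤ s₂
  2≤s₂ = ≤∧≢⇒< (half-positive 2≤s) (λ 1≡s₂ → not-both-2 (cong (_* 2) (sym 1≡s₂) , cong (_* 2) h≡1))
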